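{- Let $G$ be a trivially perfect graph on $n$ vertices with a binary cotree $T$ in which every $1$-node has at most one child that is not a leaf, and let $D$ be the table defined below. Let $\mathcal{C}$ be a well-behaved clustering of $G$, let $u\in V(T)$, and let $k_u^*$ be the size of the largest cluster of $\mathcal{C}|_{L(u)}=\{C\cap L(u):C\in\mathcal{C}\}\setminus\{\emptyset\}$. Then: (i) for each $k\in[n]$ with $D[u,k]\ne\infty$, there exists a clustering of $G[L(u)]$ of cost at most $D[u,k]$ whose largest cluster has size $k$; (ii) $D[u,k_u^*]=cost_{G[L(u)]}(\mathcal{C}|_{L(u)})$.
   Context: A cotree of $G$ is a rooted tree $T$ with leaf set $V(G)$ whose internal nodes are $0$-nodes or $1$-nodes, such that $uv\in E(G)$ iff the lowest common ancestor of $u,v$ is a $1$-node; it is binary if every internal node has exactly two children. A trivially perfect graph is a $\{P_4,C_4\}$-free graph. For $v\in V(T)$, $L(v)$ is the set of leaves descending from $v$ (a clade). A clustering of a graph $H$ is a partition of $V(H)$; its cost $cost_H(\cdot)$ is the number of edges between different parts plus the number of non-adjacent pairs within a common part; optimal means minimum cost. A clade $X$ grows in a cluster $C$ if $C\cap X\ne\emptyset$ and $C\setminus X\ne\emptyset$; $X$ has a single-growth in $\mathcal{C}$ if it grows in at most one cluster of $\mathcal{C}$. A clustering $\mathcal{C}$ of $G$ is well-behaved if it is optimal, every clade has a single-growth in $\mathcal{C}$, and $|\mathcal{C}|$ is maximum among optimal clusterings with this property. The table $D$ indexed by $V(T)\times[n]$: for a leaf $u$, $D[u,1]=0$ and $D[u,k]=\infty$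 for $k\ne1$. For an internal node $u$ with children $u_1,u_2$, let $\mathbb{I}_u=1$ if $u$ is a $1$-node and $0$ otherwise, and set $D[u,k]=\min\{\,D[u_1,k]+\min_{j\in[k]}D[u_2,j]+\mathbb{I}_u|L(u_1)||L(u_2)|,\ D[u_2,k]+\min_{j\in[k]}D[u_1,j]+\mathbb{I}_u|L(u_1)||L(u_2)|,\ \min_{j\in[k-1]}(D[u_1,j]+D[u_2,k-j]+\alpha_j(u))\,\}$, where $\alpha_j(u)=|L(u_1)||L(u_2)|-j(k-j)$ if $u$ is a $1$-node and $\alpha_j(u)=j(k-j)$ if $u$ is a $0$-node, and a minimum over an empty range is $\infty$. -}

module Defs where

open import Data.Nat using (ℕ; zero; suc; _+_; _*_; _∸_; _≤_; _⊔_; _⊓_; _≡ᵇ_; _<ᵇ_)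
open import Data.Bool using (Bool; true; false; if_then_else_; not; _∧_)
open import Data.Fin using (Fin; toℕ)
open import Data.Maybe using (Maybe; just; nothing)
open import Data.List using (List; []; _∷_; _++_; length; map; foldr; allFin)
open import Data.Nat.ListAction using (sum)
open import Data.Bool.ListAction using (any)
open import Data.Sum using (_⊎_)
open import Data.Unit using (⊤)
open import Data.List.Membership.Propositional using (_∈_)
open import Data.List.Relation.Unary.Unique.Propositional using (Unique)
open import Data.Product using (Σ; _×_; _,_; ∃)
open import Relation.Binary.PropositionalEquality using (_≡_; _≢_)
open import Relation.Nullary using (¬_; Dec; yes; no)
open import Relation.Nullary.Decidable using (⌊_⌋)
open import Function.Bundles using (_⇔_)
import Data.Fin.Properties as FinP
import Data.List.Membership.DecPropositional as DecMem

record Graph (n : ℕ) : Set where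
  field
    adj    : Fin n → Fin n → Bool
    sym    : ∀ u v → adj u v ≡ adj v u
    irrefl : ∀ u → adj u u ≡ false
open Graph public

Edge : ∀ {n} → Graph n → Fin n → Fin n → Set
Edge G u v = adj G u v ≡ true

NonEdge : ∀ {n} → Graph n → Fin n → Fin n → Set
NonEdge G u v = adj G u v ≡ false

Distinct4 : ∀ {n} → Fin n → Fin n → Fin n → Fin n → Set
Distinct4 a b c d = a ≢ b × a ≢ c × a ≢ d × b ≢ c × b ≢ d × c ≢ d

InducedP4 : ∀ {n} → Graph n → Fin n → Fin n → Fin n → Fin n → Set
InducedP4 G a b c d = Distinct4 a b c d
  × Edge G a b × Edge G b c × Edge G c d
  × NonEdge G a c × NonEdge G b d × NonEdge G a d

InducedC4 : ∀ {n} → Graph n → Fin n → Fin n → Fin n → Fin n → Set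
InducedC4 G a b c d = Distinct4 a b c d
  × Edge G a b × Edge G b c × Edge G c d × Edge G d a
  × NonEdge G a c × NonEdge G b d

TriviallyPerfect : ∀ {n} → Graph n → Set
TriviallyPerfect G = ∀ a b c d → ¬ InducedP4 G a b c d × ¬ InducedC4 G a b c d

data NodeType : Set where
  zeroN oneN : NodeType

data Cotree (n : ℕ) : Set where
  leaf : Fin n → Cotree n
  node : NodeType → Cotree n → Cotree n → Cotree n

leaves : ∀ {n} → Cotree n → List (Fin n)
leaves (leaf x)     = x ∷ []
leaves (node _ l r) = leaves l ++ leaves r

inL : ∀ {n} → Cotree n → Fin n → Bool
inL {n} t x = ⌊ DecMem._∈?_ (FinP._≟_ {n}) x (leaves t) ⌋

-- u ∈ V(T): u is (the subtree rooted at) a node of T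
data _⊑_ {n : ℕ} : Cotree n → Cotree n → Set where
  here  : ∀ {t} → t ⊑ t
  left  : ∀ {u ty l r} → u ⊑ l → u ⊑ node ty l r
  right : ∀ {u ty l r} → u ⊑ r → u ⊑ node ty l r

data LcaType {n : ℕ} : Cotree n → Fin n → Fin n → NodeType → Set where
  here-lr : ∀ {ty l r u v} → u ∈ leaves l → v ∈ leaves r → LcaType (node ty l r) u v ty
  here-rl : ∀ {ty l r u v} → u ∈ leaves r → v ∈ leaves l → LcaType (node ty l r) u v ty
  in-left  : ∀ {ty l r u v s} → LcaType l u v s → LcaType (node ty l r) u v s
  in-right : ∀ {ty l r u v s} → LcaType r u v s → LcaType (node ty l r) u v s

record IsCotreeOf {n : ℕ} (G : Graph n) (T : Cotree n) : Set where
  field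
    leavesUnique : Unique (leaves T)
    leavesCover  : ∀ v → v ∈ leaves T
    edgesLca     : ∀ u v → u ≢ v → (Edge G u v ⇔ LcaType T u v oneN)

isLeaf : ∀ {n} → Cotree n → Bool
isLeaf (leaf _)     = true
isLeaf (node _ _ _) = false

OneNodesNice : ∀ {n} → Cotree n → Set
OneNodesNice (leaf _)          = ⊤
OneNodesNice (node zeroN l r)  = OneNodesNice l × OneNodesNice r
OneNodesNice (node oneN l r)   =
  (isLeaf l ≡ true ⊎ isLeaf r ≡ true) × OneNodesNice l × OneNodesNice r

-- Clusterings, represented as labellings Fin n → ℕ (clusters = nonempty
-- fibres).  A clustering of G[S] for S ⊆ V(G) is a labelling considered
-- only on S (values outside S are irrelevant).

Clustering : ℕ → Set
Clustering n = Fin n → ℕ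

count : ∀ {n} → (Fin n → Bool) → ℕ
count {n} p = sum (map (λ i → if p i then 1 else 0) (allFin n))

badPair : ∀ {n} → Graph n → Clustering n → Fin n → Fin n → Bool
badPair G c i j = if adj G i j then not (c i ≡ᵇ c j) else (c i ≡ᵇ c j)

costOn : ∀ {n} → Graph n → (Fin n → Bool) → Clustering n → ℕ
costOn G S c =
  sum (map (λ i → count (λ j → S i ∧ S j ∧ (toℕ i <ᵇ toℕ j) ∧ badPair G c i j)) (allFin _))

cost : ∀ {n} → Graph n → Clustering n → ℕ
cost G c = costOn G (λ _ → true) c

clusterSize : ∀ {n} → (Fin n → Bool) → Clustering n → Fin n → ℕ
clusterSize S c v = count (λ w → S w ∧ (c w ≡ᵇ c v))

largestCluster : ∀ {n} → (Fin n → Bool) → Clustering n → ℕ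
largestCluster {n} S c = foldr _⊔_ 0 (map (λ v → if S v then clusterSize S c v else 0) (allFin n))

-- number of clusters |C| (number of distinct labels used)
numClusters : ∀ {n} → Clustering n → ℕ
numClusters {n} c = count (λ v → not (any (λ w → (toℕ w <ᵇ toℕ v) ∧ (c w ≡ᵇ c v)) (allFin n)))

Optimal : ∀ {n} → Graph n → Clustering n → Set
Optimal G c = ∀ c' → cost G c ≤ cost G c'

-- X has a single-growth in c: X grows in at most one cluster
-- (a cluster with label ℓ in which X grows contains some x ∈ X and y ∉ X)
SingleGrowth : ∀ {n} → (Fin n → Bool) → Clustering n → Set
SingleGrowth X c = ∀ x₁ y₁ x₂ y₂ → X x₁ ≡ true → X y₁ ≡ false → X x₂ ≡ true → X y₂ ≡ false →
  c x₁ ≡ c y₁ → c x₂ ≡ c y₂ → c x₁ ≡ c x₂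

AllSingleGrowth : ∀ {n} → Cotree n → Clustering n → Set
AllSingleGrowth T c = ∀ v → v ⊑ T → SingleGrowth (inL v) c

WellBehaved : ∀ {n} → Graph n → Cotree n → Clustering n → Set
WellBehaved G T c = Optimal G c × AllSingleGrowth T c ×
  (∀ c' → Optimal G c' → AllSingleGrowth T c' → numClusters c' ≤ numClusters c)

-- The table D, with values in ℕ ∪ {∞} represented as Maybe ℕ (nothing = ∞)

ℕ∞ : Set
ℕ∞ = Maybe ℕ

_⊕_ : ℕ∞ → ℕ∞ → ℕ∞
just a ⊕ just b = just (a + b)
_      ⊕ _      = nothing
infixl 6 _⊕_

_⊓∞_ : ℕ∞ → ℕ∞ → ℕ∞
nothing ⊓∞ y       = y
just a  ⊓∞ nothing = just a
just a  ⊓∞ just b  = just (a ⊓ b)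
infixl 5 _⊓∞_

minTo : ℕ → (ℕ → ℕ∞) → ℕ∞
minTo zero    f = nothing
minTo (suc m) f = minTo m f ⊓∞ f (suc m)

indic : NodeType → ℕ
indic zeroN = 0
indic oneN  = 1

size : ∀ {n} → Cotree n → ℕ
size t = length (leaves t)

-- α_j(u) (for a 1-node, truncated subtraction; only used when both
-- D-entries are finite, in which case it is non-negative)
alpha : NodeType → ℕ → ℕ → ℕ → ℕ → ℕ
alpha oneN  s₁ s₂ k j = s₁ * s₂ ∸ j * (k ∸ j)
alpha zeroN s₁ s₂ k j = j * (k ∸ j)

D : ∀ {n} → Cotree n → ℕ → ℕ∞
D (leaf x) 1 = just 0
D (leaf x) _ = nothing
D (node ty l r) k =
     (D l k ⊕ minTo k (D r) ⊕ just (indic ty * size l * size r))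
  ⊓∞ (D r k ⊕ minTo k (D l) ⊕ just (indic ty * size l * size r))
  ⊓∞ minTo (k ∸ 1) (λ j → D l j ⊕ D r (k ∸ j) ⊕ just (alpha ty (size l) (size r) k j))

-- (i) is proved by induction on u: each term of the recurrence is realised by combining clusterings of
-- the two children, either keeping their clusters apart or merging a largest cluster of each side, and the
-- bad pairs across the node are then I·|L(u₁)|·|L(u₂)| or α_j(u).
--
-- Clades are modules of G, so a vertex outside a clade X sees X
-- uniformly and its bad pairs with X depend only on the size of its cluster inside X. Hence if X grows in
-- a cluster C, then C ∩ X is a largest cluster of 𝒞|X: otherwise optimality makes the outside cost
-- insensitive to that size, and splitting C ∩ X off C would give an optimal clustering with single growth
-- and more clusters. So any clustering of L(u) with largest cluster of size k*_u can replace 𝒞|L(u), its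
-- largest cluster taking over the label of C, without changing the cost outside L(u); with (i) this gives
-- cost(𝒞|L(u)) ≤ D[u,k*_u]. Conversely, by single growth at most one cluster meets both children, and it
-- consists of a largest cluster of each, so 𝒞|L(u) is one of the combinations of the recurrence and
-- D[u,k*_u] ≤ cost(𝒞|L(u)).

module Submission where

open import Defs hiding (sym)
open import Data.Nat using (ℕ; zero; suc; _+_; _*_; _∸_; _≤_; _<_; _⊔_; _⊓_; _≡ᵇ_; _<ᵇ_; _≟_; z≤n; s≤s)
open import Data.Nat.Properties
open import Data.Bool using (Bool; true; false; if_then_else_; not; _∧_; _∨_)
open import Data.Bool.Properties using (T-≡; ∨-inverseʳ; ∧-inverseʳ; ∧-conicalˡ; ∧-conicalʳ; ∧-zeroʳ; ∧-identityʳ; ∧-comm; ∨-zeroʳ; ∨-identityʳ; not-injective)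
open import Data.Fin using (Fin; toℕ)
import Data.Fin.Properties as Fin
open import Data.List using (List; []; _∷_; _++_; length; map; foldr; allFin)
open import Data.Nat.ListAction using (sum)
open import Data.Bool.ListAction using (any)
open import Data.Maybe using (just; nothing)
open import Data.Product using (_×_; _,_; ∃; proj₁; proj₂)
open import Data.Sum using (_⊎_; inj₁; inj₂)
open import Data.Empty using (⊥; ⊥-elim)
open import Function using (_∘_)
open import Function.Definitions using (Injective)
open import Function.Bundles using (Equivalence)
open import Relation.Binary.PropositionalEquality
open import Relation.Binary.Definitions using (tri<; tri≈; tri>)
open import Relation.Nullary using (¬_; yes; no)
open import Relation.Nullary.Decidable using (⌊_⌋; dec-true; dec-false)
open import Data.List.Membership.Propositional using (_∈_)
open import Data.List.Membership.Propositional.Properties using (∈-allFin; ∈-++⁺ˡ; ∈-++⁺ʳ; ∈-++⁻)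
import Data.List.Membership.DecPropositional as DecMembership
open import Data.List.Relation.Unary.Any using (here; there; satisfied)
import Data.List.Relation.Unary.Any as AnyP
open import Data.List.Relation.Unary.Any.Properties using (any⁺; any⁻)
open import Data.List.Relation.Unary.All using (All; []; _∷_)
open import Data.List.Relation.Unary.AllPairs using ([]; _∷_)
import Data.List.Relation.Unary.All as All
open import Data.List.Relation.Unary.Unique.Propositional using (Unique)
open import Data.List.Relation.Unary.Unique.Propositional.Properties using (allFin⁺)
open import Data.Nat.Solver using (module +-*-Solver)
open import Algebra.Properties.CommutativeSemigroup +-commutativeSemigroup using () renaming (interchange to +-interchange)

χ : Bool → ℕ
χ b = if b then 1 else 0

true≢false : true ≢ false
true≢false ()

≡ᵇ-true : ∀ {a b} → a ≡ b → (a ≡ᵇ b) ≡ true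
≡ᵇ-true {a} {b} = dec-true (a ≟ b)

≡ᵇ-false : ∀ {a b} → a ≢ b → (a ≡ᵇ b) ≡ false
≡ᵇ-false {a} {b} = dec-false (a ≟ b)

≡ᵇ-refl : ∀ a → (a ≡ᵇ a) ≡ true
≡ᵇ-refl a = ≡ᵇ-true {a} refl

≡ᵇ-sound : ∀ {a b} → (a ≡ᵇ b) ≡ true → a ≡ b
≡ᵇ-sound {a} {b} e = ≡ᵇ⇒≡ a b (Equivalence.from T-≡ e)

≡ᵇ-false⁻ : ∀ {a b} → (a ≡ᵇ b) ≡ false → a ≢ b
≡ᵇ-false⁻ e a≡b = true≢false (trans (sym (≡ᵇ-true a≡b)) e)

≡ᵇ-cases : ∀ a b → (a ≡ b × (a ≡ᵇ b) ≡ true) ⊎ (a ≢ b × (a ≡ᵇ b) ≡ false)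
≡ᵇ-cases a b with a ≡ᵇ b in e
... | true  = inj₁ (≡ᵇ-sound e , refl)
... | false = inj₂ (≡ᵇ-false⁻ e , refl)

≡ᵇ-sym : ∀ a b → (a ≡ᵇ b) ≡ (b ≡ᵇ a)
≡ᵇ-sym a b with ≡ᵇ-cases a b
... | inj₁ (a≡b , e) = trans e (sym (≡ᵇ-true (sym a≡b)))
... | inj₂ (a≢b , e) = trans e (sym (≡ᵇ-false (a≢b ∘ sym)))

bool-cases : ∀ b → b ≡ true ⊎ b ≡ false
bool-cases true  = inj₁ refl
bool-cases false = inj₂ refl

false-∧ : ∀ {a b} → a ≡ false → a ∧ b ≡ false
false-∧ refl = refl

true-∧-false : ∀ {a b} → a ≡ true → b ≡ false → a ∧ b ≡ false
true-∧-false refl b≡false = b≡false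

true-∧-true : ∀ {a b} → a ≡ true → b ≡ true → a ∧ b ≡ true
true-∧-true refl b≡true = b≡true

∧-cong-true : ∀ {a x y} → (a ≡ true → x ≡ y) → a ∧ x ≡ a ∧ y
∧-cong-true {true}  f = f refl
∧-cong-true {false} f = refl

∑ : ∀ {A : Set} → List A → (A → ℕ) → ℕ
∑ xs f = sum (map f xs)

∑-cong : ∀ {A : Set} (xs : List A) {f g : A → ℕ} → (∀ i → f i ≡ g i) → ∑ xs f ≡ ∑ xs g
∑-cong []       e = refl
∑-cong (x ∷ xs) e = cong₂ _+_ (e x) (∑-cong xs e)

∑-+ : ∀ {A : Set} (xs : List A) (f g : A → ℕ) → ∑ xs (λ i → f i + g i) ≡ ∑ xs f + ∑ xs g
∑-+ []       f g = refl
∑-+ (x ∷ xs) f g = trans (cong (f x + g x +_) (∑-+ xs f g)) (+-interchange (f x) (g x) (∑ xs f) (∑ xs g))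

∑-mono : ∀ {A : Set} (xs : List A) {f g : A → ℕ} → (∀ i → f i ≤ g i) → ∑ xs f ≤ ∑ xs g
∑-mono []       le = z≤n
∑-mono (x ∷ xs) le = +-mono-≤ (le x) (∑-mono xs le)

∑-zero : ∀ {A : Set} (xs : List A) {f : A → ℕ} → (∀ i → f i ≡ 0) → ∑ xs f ≡ 0
∑-zero []       e = refl
∑-zero (x ∷ xs) e = cong₂ _+_ (e x) (∑-zero xs e)

∑-*ʳ : ∀ {A : Set} (xs : List A) (k : ℕ) (f : A → ℕ) → ∑ xs (λ i → f i * k) ≡ ∑ xs f * k
∑-*ʳ []       k f = refl
∑-*ʳ (x ∷ xs) k f = trans (cong (f x * k +_) (∑-*ʳ xs k f)) (sym (*-distribʳ-+ k (f x) (∑ xs f)))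

∑-comm : ∀ {A B : Set} (xs : List A) (ys : List B) (f : A → B → ℕ) →
  ∑ xs (λ i → ∑ ys (f i)) ≡ ∑ ys (λ j → ∑ xs (λ i → f i j))
∑-comm []       ys f = sym (∑-zero ys (λ _ → refl))
∑-comm (x ∷ xs) ys f = trans (cong (∑ ys (f x) +_) (∑-comm xs ys f)) (sym (∑-+ ys (f x) (λ j → ∑ xs (λ i → f i j))))

term≤∑ : ∀ {A : Set} {xs : List A} {x} (f : A → ℕ) → x ∈ xs → f x ≤ ∑ xs f
term≤∑ {xs = y ∷ xs} f (here refl) = m≤m+n (f y) _
term≤∑ {xs = y ∷ xs} f (there p)   = ≤-trans (term≤∑ f p) (m≤n+m _ (f y))

∑-mono-< : ∀ {A : Set} {xs : List A} {x} {f g : A → ℕ} → x ∈ xs → (∀ i → f i ≤ g i) → f x < g x → ∑ xs f < ∑ xs g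
∑-mono-< {xs = y ∷ xs} (here refl) le lt = +-mono-<-≤ lt (∑-mono xs le)
∑-mono-< {xs = y ∷ xs} (there p)   le lt = +-mono-≤-< (le y) (∑-mono-< p le lt)

∑-single : ∀ {A : Set} {xs : List A} {x} (f : A → ℕ) → Unique xs → x ∈ xs →
  (∀ i → i ≢ x → f i ≡ 0) → ∑ xs f ≡ f x
∑-single {xs = y ∷ xs} f (y∉xs ∷ _) (here refl) others =
  trans (cong (f y +_) (zeros xs y∉xs)) (+-identityʳ (f y))
  where
  zeros : ∀ zs → All (y ≢_) zs → ∑ zs f ≡ 0
  zeros []       _          = refl
  zeros (z ∷ zs) (y≢z ∷ ps) = cong₂ _+_ (others z (y≢z ∘ sym)) (zeros zs ps)
∑-single {xs = y ∷ xs} f (y∉xs ∷ u) (there p) others =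
  trans (cong (_+ ∑ xs f) (others y (λ y≡x → All.lookup y∉xs (subst (_∈ xs) (sym y≡x) p) refl)))
        (∑-single f u p others)

∑ᶠ : ∀ {n} → (Fin n → ℕ) → ℕ
∑ᶠ {n} f = ∑ (allFin n) f

∑∑ᶠ : ∀ {n} → (Fin n → Fin n → ℕ) → ℕ
∑∑ᶠ f = ∑ᶠ (λ i → ∑ᶠ (f i))

∑∑ᶠ-cong : ∀ {n} {f g : Fin n → Fin n → ℕ} → (∀ i j → f i j ≡ g i j) → ∑∑ᶠ f ≡ ∑∑ᶠ g
∑∑ᶠ-cong e = ∑-cong (allFin _) (λ i → ∑-cong (allFin _) (e i))

∑∑ᶠ-+ : ∀ {n} (f g : Fin n → Fin n → ℕ) → ∑∑ᶠ (λ i j → f i j + g i j) ≡ ∑∑ᶠ f + ∑∑ᶠ g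
∑∑ᶠ-+ f g = trans (∑-cong (allFin _) (λ i → ∑-+ (allFin _) (f i) (g i)))
                  (∑-+ (allFin _) (λ i → ∑ᶠ (f i)) (λ i → ∑ᶠ (g i)))

∑∑ᶠ-transpose : ∀ {n} (f : Fin n → Fin n → ℕ) → ∑∑ᶠ f ≡ ∑∑ᶠ (λ i j → f j i)
∑∑ᶠ-transpose f = ∑-comm (allFin _) (allFin _) f

module _ {n : ℕ} where

  count-cong : {p q : Fin n → Bool} → (∀ i → p i ≡ q i) → count p ≡ count q
  count-cong e = ∑-cong (allFin n) (λ i → cong χ (e i))

  count-mono : {p q : Fin n → Bool} → (∀ i → p i ≡ true → q i ≡ true) → count p ≤ count q
  count-mono {p} {q} p⇒q = ∑-mono (allFin n) pointwise
    where
    pointwise : ∀ i → χ (p i) ≤ χ (q i)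
    pointwise i with p i in e
    ... | true  rewrite p⇒q i e = ≤-refl
    ... | false = z≤n

  count-zero : {p : Fin n → Bool} → (∀ i → p i ≡ false) → count p ≡ 0
  count-zero e = ∑-zero (allFin n) (λ i → cong χ (e i))

  count-∨ : (p q : Fin n → Bool) → (∀ i → p i ∧ q i ≡ false) → count (λ i → p i ∨ q i) ≡ count p + count q
  count-∨ p q disjoint = trans (∑-cong (allFin n) pointwise) (∑-+ (allFin n) (χ ∘ p) (χ ∘ q))
    where
    pointwise : ∀ i → χ (p i ∨ q i) ≡ χ (p i) + χ (q i)
    pointwise i with p i | q i | disjoint i
    ... | true  | false | _ = refl
    ... | false | true  | _ = refl
    ... | false | false | _ = refl

  count-split : (p q : Fin n → Bool) → count p ≡ count (λ i → p i ∧ q i) + count (λ i → p i ∧ not (q i))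
  count-split p q = trans (count-cong pointwise) (count-∨ (λ i → p i ∧ q i) (λ i → p i ∧ not (q i)) disjoint)
    where
    pointwise : ∀ i → p i ≡ (p i ∧ q i) ∨ (p i ∧ not (q i))
    pointwise i with p i | q i
    ... | true  | true  = refl
    ... | true  | false = refl
    ... | false | _     = refl
    disjoint : ∀ i → (p i ∧ q i) ∧ (p i ∧ not (q i)) ≡ false
    disjoint i with p i | q i
    ... | true  | true  = refl
    ... | true  | false = refl
    ... | false | _     = refl

  count-pos : (p : Fin n → Bool) (x : Fin n) → p x ≡ true → 1 ≤ count p
  count-pos p x px = ≤-trans (≤-reflexive (cong χ (sym px))) (term≤∑ (χ ∘ p) (∈-allFin x))

  count-product : (p q : Fin n → Bool) → ∑ᶠ (λ i → count (λ j → p i ∧ q j)) ≡ count p * count q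
  count-product p q = trans (∑-cong (allFin n) row) (∑-*ʳ (allFin n) (count q) (χ ∘ p))
    where
    row : ∀ i → count (λ j → p i ∧ q j) ≡ χ (p i) * count q
    row i with p i
    ... | true  = sym (+-identityʳ _)
    ... | false = count-zero (λ _ → refl)

  count-single : (p : Fin n → Bool) (x : Fin n) → p x ≡ true → (∀ i → p i ≡ true → i ≡ x) → count p ≡ 1
  count-single p x px only-x = trans (∑-single (χ ∘ p) (allFin⁺ n) (∈-allFin x) others) (cong χ px)
    where
    others : ∀ i → i ≢ x → χ (p i) ≡ 0
    others i i≢x with p i in e
    ... | true  = ⊥-elim (i≢x (only-x i e))
    ... | false = refl

module _ {n : ℕ} where

  inList : List (Fin n) → Fin n → Bool
  inList xs x = ⌊ DecMembership._∈?_ (Fin._≟_ {n}) x xs ⌋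

  inList-true : ∀ {xs x} → x ∈ xs → inList xs x ≡ true
  inList-true {xs} {x} x∈xs with DecMembership._∈?_ Fin._≟_ x xs
  ... | yes _   = refl
  ... | no x∉xs = ⊥-elim (x∉xs x∈xs)

  inList-false : ∀ {xs x} → ¬ x ∈ xs → inList xs x ≡ false
  inList-false {xs} {x} x∉xs with DecMembership._∈?_ Fin._≟_ x xs
  ... | yes x∈xs = ⊥-elim (x∉xs x∈xs)
  ... | no _     = refl

  inList-true⁻ : ∀ {xs x} → inList xs x ≡ true → x ∈ xs
  inList-true⁻ {xs} {x} e with DecMembership._∈?_ Fin._≟_ x xs
  ... | yes x∈xs = x∈xs

  inList-false⁻ : ∀ {xs x} → inList xs x ≡ false → ¬ x ∈ xs
  inList-false⁻ e x∈xs = true≢false (trans (sym (inList-true x∈xs)) e)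

  inList-cases : ∀ xs x → (x ∈ xs × inList xs x ≡ true) ⊎ (¬ x ∈ xs × inList xs x ≡ false)
  inList-cases xs x with inList xs x in e
  ... | true  = inj₁ (inList-true⁻ e , refl)
  ... | false = inj₂ (inList-false⁻ e , refl)

  inList-++ : ∀ xs ys x → inList (xs ++ ys) x ≡ inList xs x ∨ inList ys x
  inList-++ xs ys x with inList-cases xs x | inList-cases ys x
  ... | inj₁ (x∈xs , e) | _ rewrite e = inList-true (∈-++⁺ˡ x∈xs)
  ... | inj₂ (_ , e) | inj₁ (x∈ys , e′) rewrite e | e′ = inList-true (∈-++⁺ʳ xs x∈ys)
  ... | inj₂ (x∉xs , e) | inj₂ (x∉ys , e′) rewrite e | e′ = inList-false x∉xs++ys
    where
    x∉xs++ys : ¬ x ∈ xs ++ ys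
    x∉xs++ys p with ∈-++⁻ xs p
    ... | inj₁ q = x∉xs q
    ... | inj₂ q = x∉ys q

  count-inList : ∀ xs → Unique xs → count (inList xs) ≡ length xs
  count-inList []       _          = count-zero {p = inList []} (λ _ → refl)
  count-inList (y ∷ ys) (y∉ys ∷ u) =
    trans (count-cong split) (trans (count-∨ isY (inList ys) disjoint)
      (cong₂ _+_ (count-single isY y (inList-true (here refl)) (λ i e → isY-sound (inList-true⁻ e)))
                 (count-inList ys u)))
    where
    isY : Fin n → Bool
    isY = inList (y ∷ [])
    isY-sound : ∀ {i} → i ∈ y ∷ [] → i ≡ y
    isY-sound (here refl) = refl
    split : ∀ i → inList (y ∷ ys) i ≡ isY i ∨ inList ys i
    split i = inList-++ (y ∷ []) ys i
    disjoint : ∀ i → isY i ∧ inList ys i ≡ false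
    disjoint i with inList-cases (y ∷ []) i
    ... | inj₂ (_ , e) = cong (_∧ inList ys i) e
    ... | inj₁ (here refl , e) = trans (cong (_∧ inList ys i) e) (inList-false (λ i∈ys → All.lookup y∉ys i∈ys refl))

Unique-++⁻ : ∀ {A : Set} (xs ys : List A) → Unique (xs ++ ys) →
  Unique xs × Unique ys × (∀ {z} → z ∈ xs → z ∈ ys → ⊥)
Unique-++⁻ []       ys u = [] , u , λ ()
Unique-++⁻ (x ∷ xs) ys (x∉ ∷ u) with Unique-++⁻ xs ys u
... | uxs , uys , disjoint = prefix x∉ ∷ uxs , uys , disjoint′
  where
  prefix : ∀ {zs} → All (x ≢_) (zs ++ ys) → All (x ≢_) zs
  prefix {[]}     _        = []
  prefix {z ∷ zs} (p ∷ ps) = p ∷ prefix ps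
  disjoint′ : ∀ {z} → z ∈ x ∷ xs → z ∈ ys → ⊥
  disjoint′ (here refl) q = All.lookup x∉ (∈-++⁺ʳ xs q) refl
  disjoint′ (there p)   q = disjoint p q

module _ {n : ℕ} where

  ⊑-trans : {u v w : Cotree n} → u ⊑ v → v ⊑ w → u ⊑ w
  ⊑-trans p here      = p
  ⊑-trans p (left q)  = left (⊑-trans p q)
  ⊑-trans p (right q) = right (⊑-trans p q)

  ⊑-leaves : {u t : Cotree n} {x : Fin n} → u ⊑ t → x ∈ leaves u → x ∈ leaves t
  ⊑-leaves here                      m = m
  ⊑-leaves {t = node _ l r} (left p)  m = ∈-++⁺ˡ (⊑-leaves p m)
  ⊑-leaves {t = node _ l r} (right p) m = ∈-++⁺ʳ (leaves l) (⊑-leaves p m)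

  leaves-nonempty : (t : Cotree n) → ∃ λ x → x ∈ leaves t
  leaves-nonempty (leaf x) = x , here refl
  leaves-nonempty (node _ l r) with leaves-nonempty l
  ... | x , m = x , ∈-++⁺ˡ m

  module _ (l r : Cotree n) (un : Unique (leaves l ++ leaves r)) where

    unique-left : Unique (leaves l)
    unique-left = proj₁ (Unique-++⁻ (leaves l) (leaves r) un)

    unique-right : Unique (leaves r)
    unique-right = proj₁ (proj₂ (Unique-++⁻ (leaves l) (leaves r) un))

    children-disjoint : ∀ {z} → z ∈ leaves l → z ∈ leaves r → ⊥
    children-disjoint = proj₂ (proj₂ (Unique-++⁻ (leaves l) (leaves r) un))

  ⊑-unique : {u t : Cotree n} → u ⊑ t → Unique (leaves t) → Unique (leaves u)
  ⊑-unique here      un = un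
  ⊑-unique {t = node _ l r} (left p)  un = ⊑-unique p (unique-left l r un)
  ⊑-unique {t = node _ l r} (right p) un = ⊑-unique p (unique-right l r un)

  lca-leaves : {t : Cotree n} {x y : Fin n} {s : NodeType} → LcaType t x y s → x ∈ leaves t × y ∈ leaves t
  lca-leaves {t = node _ l r} (here-lr p q) = ∈-++⁺ˡ p , ∈-++⁺ʳ (leaves l) q
  lca-leaves {t = node _ l r} (here-rl p q) = ∈-++⁺ʳ (leaves l) p , ∈-++⁺ˡ q
  lca-leaves {t = node _ l r} (in-left p)   = ∈-++⁺ˡ (proj₁ (lca-leaves p)) , ∈-++⁺ˡ (proj₂ (lca-leaves p))
  lca-leaves {t = node _ l r} (in-right p)  =
    ∈-++⁺ʳ (leaves l) (proj₁ (lca-leaves p)) , ∈-++⁺ʳ (leaves l) (proj₂ (lca-leaves p))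

  lca-functional : {t : Cotree n} {x y : Fin n} {s s′ : NodeType} →
    Unique (leaves t) → LcaType t x y s → LcaType t x y s′ → s ≡ s′
  lca-functional un (here-lr _ _) (here-lr _ _) = refl
  lca-functional un (here-rl _ _) (here-rl _ _) = refl
  lca-functional {t = node _ l r} un (in-left a)   (in-left b)   = lca-functional (unique-left l r un) a b
  lca-functional {t = node _ l r} un (in-right a)  (in-right b)  = lca-functional (unique-right l r un) a b
  lca-functional {t = node _ l r} un (here-lr p q) (here-rl p′ q′) = ⊥-elim (children-disjoint l r un p p′)
  lca-functional {t = node _ l r} un (here-lr p q) (in-left b)     = ⊥-elim (children-disjoint l r un (proj₂ (lca-leaves b)) q)
  lca-functional {t = node _ l r} un (here-lr p q) (in-right b)    = ⊥-elim (children-disjoint l r un p (proj₁ (lca-leaves b)))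
  lca-functional {t = node _ l r} un (here-rl p q) (here-lr p′ q′) = ⊥-elim (children-disjoint l r un p′ p)
  lca-functional {t = node _ l r} un (here-rl p q) (in-left b)     = ⊥-elim (children-disjoint l r un (proj₁ (lca-leaves b)) p)
  lca-functional {t = node _ l r} un (here-rl p q) (in-right b)    = ⊥-elim (children-disjoint l r un q (proj₂ (lca-leaves b)))
  lca-functional {t = node _ l r} un (in-left a)   (here-lr p q)   = ⊥-elim (children-disjoint l r un (proj₂ (lca-leaves a)) q)
  lca-functional {t = node _ l r} un (in-left a)   (here-rl p q)   = ⊥-elim (children-disjoint l r un (proj₁ (lca-leaves a)) p)
  lca-functional {t = node _ l r} un (in-left a)   (in-right b)    = ⊥-elim (children-disjoint l r un (proj₁ (lca-leaves a)) (proj₁ (lca-leaves b)))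
  lca-functional {t = node _ l r} un (in-right a)  (here-lr p q)   = ⊥-elim (children-disjoint l r un p (proj₁ (lca-leaves a)))
  lca-functional {t = node _ l r} un (in-right a)  (here-rl p q)   = ⊥-elim (children-disjoint l r un q (proj₂ (lca-leaves a)))
  lca-functional {t = node _ l r} un (in-right a)  (in-left b)     = ⊥-elim (children-disjoint l r un (proj₁ (lca-leaves b)) (proj₁ (lca-leaves a)))

  lca-⊑ : {u t : Cotree n} {x y : Fin n} {s : NodeType} → u ⊑ t → LcaType u x y s → LcaType t x y s
  lca-⊑ here      p = p
  lca-⊑ (left q)  p = in-left (lca-⊑ q p)
  lca-⊑ (right q) p = in-right (lca-⊑ q p)

  -- The lca of an outside vertex y with a leaf x of u is an ancestor of u, so it does not depend on x.
  lca-outside : {u t : Cotree n} {x x′ y : Fin n} {s : NodeType} → u ⊑ t → Unique (leaves t) →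
    x ∈ leaves u → x′ ∈ leaves u → ¬ y ∈ leaves u → LcaType t y x s → LcaType t y x′ s
  lca-outside here      un mx mx′ ny p = ⊥-elim (ny (proj₁ (lca-leaves p)))
  lca-outside {t = node _ l r} (left q)  un mx mx′ ny (here-lr p p′) = ⊥-elim (children-disjoint l r un (⊑-leaves q mx) p′)
  lca-outside (left q)  un mx mx′ ny (here-rl p p′) = here-rl p (⊑-leaves q mx′)
  lca-outside {t = node _ l r} (left q)  un mx mx′ ny (in-left p)    = in-left (lca-outside q (unique-left l r un) mx mx′ ny p)
  lca-outside {t = node _ l r} (left q)  un mx mx′ ny (in-right p)   = ⊥-elim (children-disjoint l r un (⊑-leaves q mx) (proj₂ (lca-leaves p)))
  lca-outside (right q) un mx mx′ ny (here-lr p p′) = here-lr p (⊑-leaves q mx′)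
  lca-outside {t = node _ l r} (right q) un mx mx′ ny (here-rl p p′) = ⊥-elim (children-disjoint l r un p′ (⊑-leaves q mx))
  lca-outside {t = node _ l r} (right q) un mx mx′ ny (in-left p)    = ⊥-elim (children-disjoint l r un (proj₂ (lca-leaves p)) (⊑-leaves q mx))
  lca-outside {t = node _ l r} (right q) un mx mx′ ny (in-right p)   = in-right (lca-outside q (unique-right l r un) mx mx′ ny p)

  clades-laminar : {u v t : Cotree n} {z : Fin n} → u ⊑ t → v ⊑ t → Unique (leaves t) →
    z ∈ leaves u → z ∈ leaves v →
    (∀ {w} → w ∈ leaves u → w ∈ leaves v) ⊎ (∀ {w} → w ∈ leaves v → w ∈ leaves u)
  clades-laminar here      q         un mu mv = inj₂ (⊑-leaves q)
  clades-laminar {t = t} (left p)  here un mu mv = inj₁ (⊑-leaves {t = t} (left p))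
  clades-laminar {t = t} (right p) here un mu mv = inj₁ (⊑-leaves {t = t} (right p))
  clades-laminar {t = node _ l r} (left p)  (left q)  un mu mv = clades-laminar p q (unique-left l r un) mu mv
  clades-laminar {t = node _ l r} (right p) (right q) un mu mv = clades-laminar p q (unique-right l r un) mu mv
  clades-laminar {t = node _ l r} (left p)  (right q) un mu mv = ⊥-elim (children-disjoint l r un (⊑-leaves p mu) (⊑-leaves q mv))
  clades-laminar {t = node _ l r} (right p) (left q)  un mu mv = ⊥-elim (children-disjoint l r un (⊑-leaves q mv) (⊑-leaves p mu))

before : ∀ {n} → Fin n → Fin n → Bool
before i j = toℕ i <ᵇ toℕ j

<ᵇ-false : ∀ {m k} → ¬ m < k → (m <ᵇ k) ≡ false
<ᵇ-false {m} {k} m≮k with m <ᵇ k in e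
... | true  = ⊥-elim (m≮k (<ᵇ⇒< m k (Equivalence.from T-≡ e)))
... | false = refl

before-irrefl : ∀ {n} (i : Fin n) → before i i ≡ false
before-irrefl i = <ᵇ-false (n≮n (toℕ i))

before-connex : ∀ {n} (i j : Fin n) → i ≢ j →
  (before i j ≡ true × before j i ≡ false) ⊎ (before i j ≡ false × before j i ≡ true)
before-connex i j i≢j with <-cmp (toℕ i) (toℕ j)
... | tri< i<j _ j≮i = inj₁ (Equivalence.to T-≡ (<⇒<ᵇ i<j) , <ᵇ-false j≮i)
... | tri≈ _ i≡j _   = ⊥-elim (i≢j (Fin.toℕ-injective i≡j))
... | tri> i≮j _ j<i = inj₂ (<ᵇ-false i≮j , Equivalence.to T-≡ (<⇒<ᵇ j<i))

χ-pairs-in-union : ∀ a₁ b₁ a₂ b₂ x → a₁ ∧ b₁ ≡ false → a₂ ∧ b₂ ≡ false →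
  χ ((a₁ ∨ b₁) ∧ (a₂ ∨ b₂) ∧ x) ≡ χ (a₁ ∧ a₂ ∧ x) + χ (b₁ ∧ b₂ ∧ x) + χ (a₁ ∧ b₂ ∧ x) + χ (b₁ ∧ a₂ ∧ x)
χ-pairs-in-union true  true  _     _     _     () _
χ-pairs-in-union _     _     true  true  _     _  ()
χ-pairs-in-union true  false true  false true  _  _ = refl
χ-pairs-in-union true  false true  false false _  _ = refl
χ-pairs-in-union true  false false true  true  _  _ = refl
χ-pairs-in-union true  false false true  false _  _ = refl
χ-pairs-in-union true  false false false x     _  _ = refl
χ-pairs-in-union false true  true  false true  _  _ = refl
χ-pairs-in-union false true  true  false false _  _ = refl
χ-pairs-in-union false true  false true  true  _  _ = refl
χ-pairs-in-union false true  false true  false _  _ = refl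
χ-pairs-in-union false true  false false x     _  _ = refl
χ-pairs-in-union false false true  false x     _  _ = refl
χ-pairs-in-union false false false true  x     _  _ = refl
χ-pairs-in-union false false false false x     _  _ = refl

χ-one-order : ∀ a b o₁ o₂ x → (a ∧ b ≡ true → (o₁ ≡ true × o₂ ≡ false) ⊎ (o₁ ≡ false × o₂ ≡ true)) →
  χ (a ∧ b ∧ o₁ ∧ x) + χ (a ∧ b ∧ o₂ ∧ x) ≡ χ (a ∧ b ∧ x)
χ-one-order true  true  o₁ o₂ x h with h refl
... | inj₁ (refl , refl) = +-identityʳ _
... | inj₂ (refl , refl) = refl
χ-one-order true  false o₁ o₂ x h = refl
χ-one-order false b     o₁ o₂ x h = refl

module ClusteringCost {n : ℕ} (G : Graph n) where

  -- ordered pairs i ∈ A, j ∈ B, without the i < j of costOn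
  crossCost : (Fin n → Bool) → (Fin n → Bool) → Clustering n → ℕ
  crossCost A B c = ∑ᶠ (λ i → count (λ j → A i ∧ B j ∧ badPair G c i j))

  badPair-sym : ∀ (c : Clustering n) i j → badPair G c i j ≡ badPair G c j i
  badPair-sym c i j rewrite Graph.sym G i j | ≡ᵇ-sym (c i) (c j) = refl

  badPair-cong : ∀ (c c′ : Clustering n) i j → (c i ≡ᵇ c j) ≡ (c′ i ≡ᵇ c′ j) → badPair G c i j ≡ badPair G c′ i j
  badPair-cong c c′ i j e = cong (λ b → if adj G i j then not b else b) e

  crossCost-sym : ∀ (A B : Fin n → Bool) c → crossCost A B c ≡ crossCost B A c
  crossCost-sym A B c = trans (∑∑ᶠ-transpose (λ i j → χ (A i ∧ B j ∧ badPair G c i j))) (∑∑ᶠ-cong swap)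
    where
    swap : ∀ i j → χ (A j ∧ B i ∧ badPair G c j i) ≡ χ (B i ∧ A j ∧ badPair G c i j)
    swap i j rewrite badPair-sym c j i with A j | B i
    ... | true  | true  = refl
    ... | true  | false = refl
    ... | false | true  = refl
    ... | false | false = refl

  costOn-∪ : ∀ (S A B : Fin n → Bool) (c : Clustering n) → (∀ i → S i ≡ A i ∨ B i) → (∀ i → A i ∧ B i ≡ false) →
    costOn G S c ≡ costOn G A c + costOn G B c + crossCost A B c
  costOn-∪ S A B c S≡A∨B disjoint = begin
      costOn G S c
    ≡⟨ ∑∑ᶠ-cong four-kinds ⟩
      ∑∑ᶠ (λ i j → pair A A i j + pair B B i j + pair A B i j + pair B A i j)
    ≡⟨ ∑∑ᶠ-+ (λ i j → pair A A i j + pair B B i j + pair A B i j) (pair B A) ⟩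
      ∑∑ᶠ (λ i j → pair A A i j + pair B B i j + pair A B i j) + ∑∑ᶠ (pair B A)
    ≡⟨ cong (_+ ∑∑ᶠ (pair B A)) (∑∑ᶠ-+ (λ i j → pair A A i j + pair B B i j) (pair A B)) ⟩
      ∑∑ᶠ (λ i j → pair A A i j + pair B B i j) + ∑∑ᶠ (pair A B) + ∑∑ᶠ (pair B A)
    ≡⟨ cong (λ z → z + ∑∑ᶠ (pair A B) + ∑∑ᶠ (pair B A)) (∑∑ᶠ-+ (pair A A) (pair B B)) ⟩
      costOn G A c + costOn G B c + ∑∑ᶠ (pair A B) + ∑∑ᶠ (pair B A)
    ≡⟨ +-assoc (costOn G A c + costOn G B c) _ _ ⟩
      costOn G A c + costOn G B c + (∑∑ᶠ (pair A B) + ∑∑ᶠ (pair B A))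
    ≡⟨ cong (costOn G A c + costOn G B c +_) both-orders ⟩
      costOn G A c + costOn G B c + crossCost A B c
    ∎
    where
    open ≡-Reasoning
    pair : (Fin n → Bool) → (Fin n → Bool) → Fin n → Fin n → ℕ
    pair P Q i j = χ (P i ∧ Q j ∧ before i j ∧ badPair G c i j)
    four-kinds : ∀ i j → χ (S i ∧ S j ∧ before i j ∧ badPair G c i j) ≡
                         pair A A i j + pair B B i j + pair A B i j + pair B A i j
    four-kinds i j rewrite S≡A∨B i | S≡A∨B j =
      χ-pairs-in-union (A i) (B i) (A j) (B j) (before i j ∧ badPair G c i j) (disjoint i) (disjoint j)
    flipped : ∑∑ᶠ (pair B A) ≡ ∑∑ᶠ (λ i j → χ (A i ∧ B j ∧ before j i ∧ badPair G c i j))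
    flipped = trans (∑∑ᶠ-transpose (pair B A)) (∑∑ᶠ-cong swap)
      where
      swap : ∀ i j → pair B A j i ≡ χ (A i ∧ B j ∧ before j i ∧ badPair G c i j)
      swap i j rewrite badPair-sym c j i with A i | B j
      ... | true  | true  = refl
      ... | true  | false = refl
      ... | false | true  = refl
      ... | false | false = refl
    distinct : ∀ i j → A i ∧ B j ≡ true → i ≢ j
    distinct i j e refl = true≢false (trans (sym e) (disjoint i))
    both-orders : ∑∑ᶠ (pair A B) + ∑∑ᶠ (pair B A) ≡ crossCost A B c
    both-orders = trans (cong (∑∑ᶠ (pair A B) +_) flipped)
      (trans (sym (∑∑ᶠ-+ (pair A B) (λ i j → χ (A i ∧ B j ∧ before j i ∧ badPair G c i j))))
        (∑∑ᶠ-cong (λ i j → χ-one-order (A i) (B j) (before i j) (before j i) (badPair G c i j)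
                              (λ e → before-connex i j (distinct i j e)))))

  costOn-cong : ∀ (S : Fin n → Bool) (c c′ : Clustering n) →
    (∀ i j → S i ≡ true → S j ≡ true → (c i ≡ᵇ c j) ≡ (c′ i ≡ᵇ c′ j)) → costOn G S c ≡ costOn G S c′
  costOn-cong S c c′ same = ∑∑ᶠ-cong (λ i j → cong χ (∧-cong-true λ Si → ∧-cong-true λ Sj →
    cong (before i j ∧_) (badPair-cong c c′ i j (same i j Si Sj))))

  clusterSize-cong : ∀ (S : Fin n → Bool) (c c′ : Clustering n) v →
    (∀ w → S w ≡ true → (c w ≡ᵇ c v) ≡ (c′ w ≡ᵇ c′ v)) → clusterSize S c v ≡ clusterSize S c′ v
  clusterSize-cong S c c′ v same = count-cong (λ w → ∧-cong-true (same w))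

  clusterSize-label : ∀ (S : Fin n → Bool) (c : Clustering n) v v′ → c v ≡ c v′ → clusterSize S c v ≡ clusterSize S c v′
  clusterSize-label S c v v′ e = count-cong (λ w → cong (λ ℓ → S w ∧ (c w ≡ᵇ ℓ)) e)

  clusterSize-pos : ∀ (S : Fin n → Bool) (c : Clustering n) v → S v ≡ true → 1 ≤ clusterSize S c v
  clusterSize-pos S c v Sv = count-pos _ v (trans (cong (_∧ (c v ≡ᵇ c v)) Sv) (≡ᵇ-refl (c v)))

  clusterSize≤count : ∀ (S : Fin n → Bool) (c : Clustering n) v → clusterSize S c v ≤ count S
  clusterSize≤count S c v = count-mono (λ w e → ∧-conicalˡ (S w) _ e)

  clusterSize-∪ : ∀ (S A B : Fin n → Bool) (c : Clustering n) v → (∀ i → S i ≡ A i ∨ B i) → (∀ i → A i ∧ B i ≡ false) →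
    clusterSize S c v ≡ clusterSize A c v + clusterSize B c v
  clusterSize-∪ S A B c v S≡A∨B disjoint =
    trans (count-cong split) (count-∨ (λ w → A w ∧ (c w ≡ᵇ c v)) (λ w → B w ∧ (c w ≡ᵇ c v)) disjoint′)
    where
    split : ∀ w → S w ∧ (c w ≡ᵇ c v) ≡ (A w ∧ (c w ≡ᵇ c v)) ∨ (B w ∧ (c w ≡ᵇ c v))
    split w rewrite S≡A∨B w with A w | B w | disjoint w
    ... | true  | false | _ = sym (∨-identityʳ _)
    ... | false | true  | _ = refl
    ... | false | false | _ = refl
    disjoint′ : ∀ w → (A w ∧ (c w ≡ᵇ c v)) ∧ (B w ∧ (c w ≡ᵇ c v)) ≡ false
    disjoint′ w with A w | B w | disjoint w
    ... | true  | false | _ = ∧-zeroʳ _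
    ... | false | _     | _ = refl

  private
    sizeIn : (Fin n → Bool) → Clustering n → Fin n → ℕ
    sizeIn S c v = if S v then clusterSize S c v else 0

    ≤-foldr-⊔ : ∀ (xs : List (Fin n)) (f : Fin n → ℕ) {v} → v ∈ xs → f v ≤ foldr _⊔_ 0 (map f xs)
    ≤-foldr-⊔ (x ∷ xs) f (here refl) = m≤m⊔n (f x) _
    ≤-foldr-⊔ (x ∷ xs) f (there p)   = ≤-trans (≤-foldr-⊔ xs f p) (m≤n⊔m (f x) _)

    foldr-⊔-≤ : ∀ (xs : List (Fin n)) (f : Fin n → ℕ) {k} → (∀ v → f v ≤ k) → foldr _⊔_ 0 (map f xs) ≤ k
    foldr-⊔-≤ []       f bound = z≤n
    foldr-⊔-≤ (x ∷ xs) f bound = ⊔-lub (bound x) (foldr-⊔-≤ xs f bound)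

    foldr-⊔-attained : ∀ (xs : List (Fin n)) (f : Fin n → ℕ) → 1 ≤ foldr _⊔_ 0 (map f xs) →
      ∃ λ v → f v ≡ foldr _⊔_ 0 (map f xs)
    foldr-⊔-attained (x ∷ xs) f pos with ⊔-sel (f x) (foldr _⊔_ 0 (map f xs))
    ... | inj₁ e = x , sym e
    ... | inj₂ e with foldr-⊔-attained xs f (subst (1 ≤_) e pos)
    ...   | v , ev = v , trans ev (sym e)

  clusterSize≤largest : ∀ (S : Fin n → Bool) (c : Clustering n) v → S v ≡ true → clusterSize S c v ≤ largestCluster S c
  clusterSize≤largest S c v Sv = subst (_≤ largestCluster S c) (cong (λ b → if b then clusterSize S c v else 0) Sv)
                                   (≤-foldr-⊔ (allFin n) (sizeIn S c) (∈-allFin v))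

  largest≤ : ∀ (S : Fin n → Bool) (c : Clustering n) k → (∀ v → S v ≡ true → clusterSize S c v ≤ k) → largestCluster S c ≤ k
  largest≤ S c k bound = foldr-⊔-≤ (allFin n) (sizeIn S c) bound′
    where
    bound′ : ∀ v → sizeIn S c v ≤ k
    bound′ v with S v in e
    ... | true  = bound v e
    ... | false = z≤n

  largest-attained : ∀ (S : Fin n → Bool) (c : Clustering n) → 1 ≤ largestCluster S c →
    ∃ λ v → S v ≡ true × clusterSize S c v ≡ largestCluster S c
  largest-attained S c pos with foldr-⊔-attained (allFin n) (sizeIn S c) pos
  ... | v , ev with S v in e
  ...   | true  = v , e , ev
  ...   | false = ⊥-elim (<⇒≢ pos ev)

  largest≡ : ∀ (S : Fin n → Bool) (c : Clustering n) k v → (∀ w → S w ≡ true → clusterSize S c w ≤ k) →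
    S v ≡ true → clusterSize S c v ≡ k → largestCluster S c ≡ k
  largest≡ S c k v bound Sv e = ≤-antisym (largest≤ S c k bound) (subst (_≤ largestCluster S c) e (clusterSize≤largest S c v Sv))

  largest-pos : ∀ (S : Fin n → Bool) (c : Clustering n) v → S v ≡ true → 1 ≤ largestCluster S c
  largest-pos S c v Sv = ≤-trans (clusterSize-pos S c v Sv) (clusterSize≤largest S c v Sv)

  costOn-leaf : ∀ x (c : Clustering n) → costOn G (inL (leaf x)) c ≡ 0
  costOn-leaf x c = ∑-zero (allFin n) (λ i → count-zero (λ j → no-pair i j))
    where
    no-pair : ∀ i j → inL (leaf x) i ∧ inL (leaf x) j ∧ before i j ∧ badPair G c i j ≡ false
    no-pair i j with inList-cases (x ∷ []) i | inList-cases (x ∷ []) j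
    ... | inj₂ (_ , e)         | _                    = false-∧ e
    ... | inj₁ (_ , e)         | inj₂ (_ , e′)        = true-∧-false e (false-∧ e′)
    ... | inj₁ (here refl , e) | inj₁ (here refl , e′) = true-∧-false e (true-∧-false e′ (false-∧ (before-irrefl x)))

  largest-leaf : ∀ x (c : Clustering n) → largestCluster (inL (leaf x)) c ≡ 1
  largest-leaf x c = ≤-antisym (largest≤ S c 1 (λ v _ → subst (clusterSize S c v ≤_) count-S (clusterSize≤count S c v)))
                               (largest-pos S c x (inList-true (here refl)))
    where
    S = inL (leaf x)
    count-S : count S ≡ 1
    count-S = count-inList (x ∷ []) ([] ∷ [])

  GluedAlong : (A B : Fin n → Bool) → Clustering n → (P Q : Fin n → Bool) → Set
  GluedAlong A B c P Q = ∀ i j → A i ≡ true → B j ≡ true → (c i ≡ᵇ c j) ≡ P i ∧ Q j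

  GluedAlong-sym : ∀ {A B c P Q} → GluedAlong A B c P Q → GluedAlong B A c Q P
  GluedAlong-sym {c = c} {P} {Q} glued i j Bi Aj =
    trans (≡ᵇ-sym (c i) (c j)) (trans (glued j i Aj Bi) (∧-comm (P j) (Q i)))

  count-pairs : ∀ (A B P Q : Fin n → Bool) →
    ∑∑ᶠ (λ i j → χ (A i ∧ B j ∧ (P i ∧ Q j))) ≡ count (λ i → A i ∧ P i) * count (λ j → B j ∧ Q j)
  count-pairs A B P Q = trans (∑∑ᶠ-cong regroup) (count-product (λ i → A i ∧ P i) (λ j → B j ∧ Q j))
    where
    regroup : ∀ i j → χ (A i ∧ B j ∧ (P i ∧ Q j)) ≡ χ ((A i ∧ P i) ∧ (B j ∧ Q j))
    regroup i j with A i | B j | P i | Q j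
    ... | true  | true  | true  | true  = refl
    ... | true  | true  | true  | false = refl
    ... | true  | true  | false | _     = refl
    ... | true  | false | true  | _     = refl
    ... | true  | false | false | _     = refl
    ... | false | _     | _     | _     = refl

  crossCost-glued : ∀ (A B : Fin n → Bool) (c : Clustering n) (P Q : Fin n → Bool) β →
    (∀ i j → A i ≡ true → B j ≡ true → adj G i j ≡ β) → GluedAlong A B c P Q →
    crossCost A B c ≡ (if β then count A * count B ∸ count (λ i → A i ∧ P i) * count (λ j → B j ∧ Q j)
                            else count (λ i → A i ∧ P i) * count (λ j → B j ∧ Q j))
  crossCost-glued A B c P Q false adj≡β glued = trans (∑∑ᶠ-cong (λ i j → cong χ (bad≡ i j))) (count-pairs A B P Q)
    where
    bad≡ : ∀ i j → A i ∧ B j ∧ badPair G c i j ≡ A i ∧ B j ∧ (P i ∧ Q j)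
    bad≡ i j = ∧-cong-true λ Ai → ∧-cong-true λ Bj →
      cong₂ (λ a e → if a then not e else e) (adj≡β i j Ai Bj) (glued i j Ai Bj)
  crossCost-glued A B c P Q true adj≡β glued = begin
      crossCost A B c
    ≡⟨ sym (m+n∸n≡m (crossCost A B c) (∑∑ᶠ inside)) ⟩
      crossCost A B c + ∑∑ᶠ inside ∸ ∑∑ᶠ inside
    ≡⟨ cong (λ x → x + ∑∑ᶠ inside ∸ ∑∑ᶠ inside) (∑∑ᶠ-cong (λ i j → cong χ (bad≡ i j))) ⟩
      ∑∑ᶠ outside + ∑∑ᶠ inside ∸ ∑∑ᶠ inside
    ≡⟨ cong (_∸ ∑∑ᶠ inside) (sym (∑∑ᶠ-+ outside inside)) ⟩
      ∑∑ᶠ (λ i j → outside i j + inside i j) ∸ ∑∑ᶠ inside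
    ≡⟨ cong₂ _∸_ (trans (∑∑ᶠ-cong (λ i j → split (A i) (B j) (P i ∧ Q j))) (count-product A B)) (count-pairs A B P Q) ⟩
      count A * count B ∸ count (λ i → A i ∧ P i) * count (λ j → B j ∧ Q j)
    ∎
    where
    open ≡-Reasoning
    inside outside : Fin n → Fin n → ℕ
    inside  i j = χ (A i ∧ B j ∧ (P i ∧ Q j))
    outside i j = χ (A i ∧ B j ∧ not (P i ∧ Q j))
    bad≡ : ∀ i j → A i ∧ B j ∧ badPair G c i j ≡ A i ∧ B j ∧ not (P i ∧ Q j)
    bad≡ i j = ∧-cong-true λ Ai → ∧-cong-true λ Bj →
      cong₂ (λ a e → if a then not e else e) (adj≡β i j Ai Bj) (glued i j Ai Bj)
    split : ∀ a b x → χ (a ∧ b ∧ not x) + χ (a ∧ b ∧ x) ≡ χ (a ∧ b)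
    split true  true  true  = refl
    split true  true  false = refl
    split true  false _     = refl
    split false _     _     = refl

  clusterSize-glued : ∀ (A B : Fin n → Bool) (c : Clustering n) (P Q : Fin n → Bool) v → A v ≡ true →
    GluedAlong A B c P Q → clusterSize B c v ≡ (if P v then count (λ j → B j ∧ Q j) else 0)
  clusterSize-glued A B c P Q v Av glued with P v in ePv
  ... | true  = count-cong λ w → ∧-cong-true λ Bw → together w Bw
    where
    together : ∀ w → B w ≡ true → (c w ≡ᵇ c v) ≡ Q w
    together w Bw = trans (≡ᵇ-sym (c w) (c v)) (trans (glued v w Av Bw) (cong (_∧ Q w) ePv))
  ... | false = count-zero apart
    where
    apart : ∀ w → B w ∧ (c w ≡ᵇ c v) ≡ false
    apart w with B w in eBw
    ... | true  = trans (≡ᵇ-sym (c w) (c v)) (trans (glued v w Av eBw) (cong (_∧ Q w) ePv))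
    ... | false = refl

⊓∞-sel : ∀ (x y : ℕ∞) {d} → x ⊓∞ y ≡ just d → x ≡ just d ⊎ y ≡ just d
⊓∞-sel nothing  y        e = inj₂ e
⊓∞-sel (just a) nothing  e = inj₁ e
⊓∞-sel (just a) (just b) e with ⊓-sel a b
... | inj₁ a⊓b≡a = inj₁ (trans (cong just (sym a⊓b≡a)) e)
... | inj₂ a⊓b≡b = inj₂ (trans (cong just (sym a⊓b≡b)) e)

⊕-just⁻ : ∀ (x y : ℕ∞) {d} → x ⊕ y ≡ just d → ∃ λ a → ∃ λ b → x ≡ just a × y ≡ just b × d ≡ a + b
⊕-just⁻ (just a) (just b) refl = a , b , refl , refl , refl

minTo-attained : ∀ m (f : ℕ → ℕ∞) {d} → minTo m f ≡ just d → ∃ λ j → 1 ≤ j × j ≤ m × f j ≡ just d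
minTo-attained (suc m) f e with ⊓∞-sel (minTo m f) (f (suc m)) e
... | inj₂ e′ = suc m , s≤s z≤n , ≤-refl , e′
... | inj₁ e′ with minTo-attained m f e′
...   | j , 1≤j , j≤m , fj = j , 1≤j , m≤n⇒m≤1+n j≤m , fj

AtMost : ℕ∞ → ℕ → Set
AtMost x a = ∃ λ d → x ≡ just d × d ≤ a

AtMost-just : ∀ {x a} → x ≡ just a → AtMost x a
AtMost-just {a = a} e = a , e , ≤-refl

AtMost-weaken : ∀ {x a b} → a ≤ b → AtMost x a → AtMost x b
AtMost-weaken a≤b (d , e , d≤a) = d , e , ≤-trans d≤a a≤b

⊓∞-AtMostˡ : ∀ (x y : ℕ∞) {a} → AtMost x a → AtMost (x ⊓∞ y) a
⊓∞-AtMostˡ (just d) nothing  (d , refl , d≤a) = d , refl , d≤a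
⊓∞-AtMostˡ (just d) (just b) (d , refl , d≤a) = d ⊓ b , refl , ≤-trans (m⊓n≤m d b) d≤a

⊓∞-AtMostʳ : ∀ (x y : ℕ∞) {a} → AtMost y a → AtMost (x ⊓∞ y) a
⊓∞-AtMostʳ nothing  (just d) (d , refl , d≤a) = d , refl , d≤a
⊓∞-AtMostʳ (just b) (just d) (d , refl , d≤a) = b ⊓ d , refl , ≤-trans (m⊓n≤n b d) d≤a

⊕-AtMost : ∀ {x y a b} → AtMost x a → AtMost y b → AtMost (x ⊕ y) (a + b)
⊕-AtMost (d , refl , d≤a) (d′ , refl , d′≤b) = d + d′ , refl , +-mono-≤ d≤a d′≤b

minTo-AtMost : ∀ m (f : ℕ → ℕ∞) j {a} → 1 ≤ j → j ≤ m → AtMost (f j) a → AtMost (minTo m f) a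
minTo-AtMost zero    f (suc j) 1≤j () fj
minTo-AtMost (suc m) f j 1≤j j≤1+m fj with m≤n⇒m<n∨m≡n j≤1+m
... | inj₂ refl        = ⊓∞-AtMostʳ (minTo m f) (f (suc m)) fj
... | inj₁ (s≤s j≤m) = ⊓∞-AtMostˡ (minTo m f) (f (suc m)) (minTo-AtMost m f j 1≤j j≤m fj)

≡ᵇ-preserved : ∀ (f : ℕ → ℕ) → Injective _≡_ _≡_ f → ∀ a b → (f a ≡ᵇ f b) ≡ (a ≡ᵇ b)
≡ᵇ-preserved f f-inj a b with ≡ᵇ-cases a b
... | inj₁ (refl , e) = trans (≡ᵇ-refl (f a)) (sym e)
... | inj₂ (a≢b , e) = trans (≡ᵇ-false (a≢b ∘ f-inj)) (sym e)

redirect : ℕ → ℕ → (ℕ → ℕ) → ℕ → ℕ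
redirect ℓ t f m = if m ≡ᵇ ℓ then t else f m

redirect-injective : ∀ ℓ t (f : ℕ → ℕ) → Injective _≡_ _≡_ f → (∀ m → m ≢ ℓ → f m ≢ t) →
  Injective _≡_ _≡_ (redirect ℓ t f)
redirect-injective ℓ t f f-inj avoids {a} {b} e with ≡ᵇ-cases a ℓ | ≡ᵇ-cases b ℓ
... | inj₁ (a≡ℓ , _)  | inj₁ (b≡ℓ , _)  = trans a≡ℓ (sym b≡ℓ)
... | inj₁ (_ , ea)   | inj₂ (b≢ℓ , eb) rewrite ea | eb = ⊥-elim (avoids b b≢ℓ (sym e))
... | inj₂ (a≢ℓ , ea) | inj₁ (_ , eb)   rewrite ea | eb = ⊥-elim (avoids a a≢ℓ e)
... | inj₂ (_ , ea)   | inj₂ (_ , eb)   rewrite ea | eb = f-inj e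

redirect-meet : ∀ ℓ₁ ℓ₂ t (f₁ f₂ : ℕ → ℕ) → (∀ a b → f₁ a ≢ f₂ b) → (∀ m → f₁ m ≢ t) → (∀ m → f₂ m ≢ t) →
  ∀ a b → (redirect ℓ₁ t f₁ a ≡ᵇ redirect ℓ₂ t f₂ b) ≡ (a ≡ᵇ ℓ₁) ∧ (b ≡ᵇ ℓ₂)
redirect-meet ℓ₁ ℓ₂ t f₁ f₂ apart avoids₁ avoids₂ a b with ≡ᵇ-cases a ℓ₁ | ≡ᵇ-cases b ℓ₂
... | inj₁ (_ , ea) | inj₁ (_ , eb) rewrite ea | eb = ≡ᵇ-refl t
... | inj₁ (_ , ea) | inj₂ (_ , eb) rewrite ea | eb = ≡ᵇ-false (avoids₂ b ∘ sym)
... | inj₂ (_ , ea) | inj₁ (_ , eb) rewrite ea | eb = ≡ᵇ-false (avoids₁ a)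
... | inj₂ (_ , ea) | inj₂ (_ , eb) rewrite ea | eb = ≡ᵇ-false (apart a b)

transpose : ℕ → ℕ → ℕ → ℕ
transpose ℓ ℓ′ m = if m ≡ᵇ ℓ then ℓ′ else if m ≡ᵇ ℓ′ then ℓ else m

transpose-involutive : ∀ ℓ ℓ′ m → ℓ ≢ ℓ′ → transpose ℓ ℓ′ (transpose ℓ ℓ′ m) ≡ m
transpose-involutive ℓ ℓ′ m ℓ≢ℓ′ with ≡ᵇ-cases m ℓ
... | inj₁ (refl , e) rewrite e | ≡ᵇ-false (ℓ≢ℓ′ ∘ sym) | ≡ᵇ-refl ℓ′ = refl
... | inj₂ (_ , e) rewrite e with ≡ᵇ-cases m ℓ′
...   | inj₁ (refl , e′) rewrite e′ | ≡ᵇ-refl ℓ = refl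
...   | inj₂ (_ , e′) rewrite e′ | e | e′ = refl

transpose-injective : ∀ ℓ ℓ′ → ℓ ≢ ℓ′ → Injective _≡_ _≡_ (transpose ℓ ℓ′)
transpose-injective ℓ ℓ′ ℓ≢ℓ′ {a} {b} e =
  trans (sym (transpose-involutive ℓ ℓ′ a ℓ≢ℓ′)) (trans (cong (transpose ℓ ℓ′) e) (transpose-involutive ℓ ℓ′ b ℓ≢ℓ′))

transpose-≡ᵇ-left : ∀ ℓ ℓ′ m → ℓ ≢ ℓ′ → (transpose ℓ ℓ′ m ≡ᵇ ℓ) ≡ (m ≡ᵇ ℓ′)
transpose-≡ᵇ-left ℓ ℓ′ m ℓ≢ℓ′ with ≡ᵇ-cases m ℓ
... | inj₁ (refl , e) rewrite e = trans (≡ᵇ-false (ℓ≢ℓ′ ∘ sym)) (sym (≡ᵇ-false ℓ≢ℓ′))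
... | inj₂ (_ , e) rewrite e with ≡ᵇ-cases m ℓ′
...   | inj₁ (refl , e′) rewrite e′ = ≡ᵇ-refl ℓ
...   | inj₂ (_ , e′) rewrite e′ = e

transpose-≡ᵇ-other : ∀ ℓ ℓ′ m t → t ≢ ℓ → t ≢ ℓ′ → (transpose ℓ ℓ′ m ≡ᵇ t) ≡ (m ≡ᵇ t)
transpose-≡ᵇ-other ℓ ℓ′ m t t≢ℓ t≢ℓ′ with ≡ᵇ-cases m ℓ
... | inj₁ (refl , e) rewrite e = trans (≡ᵇ-false (t≢ℓ′ ∘ sym)) (sym (≡ᵇ-false (t≢ℓ ∘ sym)))
... | inj₂ (_ , e) rewrite e with ≡ᵇ-cases m ℓ′
...   | inj₁ (refl , e′) rewrite e′ = trans (≡ᵇ-false (t≢ℓ ∘ sym)) (sym (≡ᵇ-false (t≢ℓ′ ∘ sym)))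
...   | inj₂ (_ , e′) rewrite e′ = refl

record Merging (Join₁ Join₂ : ℕ → Bool) : Set where
  field
    code₁ code₂ : ℕ → ℕ
    code₁-injective : Injective _≡_ _≡_ code₁
    code₂-injective : Injective _≡_ _≡_ code₂
    code-meet : ∀ a b → (code₁ a ≡ᵇ code₂ b) ≡ Join₁ a ∧ Join₂ b

even-injective : Injective _≡_ _≡_ (2 *_)
even-injective {a} {b} = *-cancelˡ-≡ a b 2

odd-injective : Injective _≡_ _≡_ (suc ∘ (2 *_))
odd-injective = even-injective ∘ suc-injective

keepApart : Merging (λ _ → false) (λ _ → false)
keepApart = record
  { code₁ = 2 *_
  ; code₂ = suc ∘ (2 *_)
  ; code₁-injective = even-injective
  ; code₂-injective = odd-injective
  ; code-meet = λ a b → ≡ᵇ-false (even≢odd a b)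
  }

mergeAt : ∀ ℓ₁ ℓ₂ → Merging (_≡ᵇ ℓ₁) (_≡ᵇ ℓ₂)
mergeAt ℓ₁ ℓ₂ = record
  { code₁ = redirect ℓ₁ 0 (suc ∘ (2 *_))
  ; code₂ = redirect ℓ₂ 0 (suc ∘ suc ∘ (2 *_))
  ; code₁-injective = redirect-injective ℓ₁ 0 _ odd-injective (λ _ _ ())
  ; code₂-injective = redirect-injective ℓ₂ 0 _ (odd-injective ∘ suc-injective) (λ _ _ ())
  ; code-meet = redirect-meet ℓ₁ ℓ₂ 0 _ _ (λ a b → even≢odd a b ∘ suc-injective) (λ _ ()) (λ _ ())
  }

isOne : NodeType → Bool
isOne oneN  = true
isOne zeroN = false

-- bad pairs between the two sides of a node, of sizes s₁ and s₂, when m pairs across share a cluster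
crossTerm : NodeType → ℕ → ℕ → ℕ → ℕ
crossTerm ty s₁ s₂ m = if isOne ty then s₁ * s₂ ∸ m else m

crossTerm-glued : ∀ ty s₁ s₂ k j → crossTerm ty s₁ s₂ (j * (k ∸ j)) ≡ alpha ty s₁ s₂ k j
crossTerm-glued oneN  s₁ s₂ k j = refl
crossTerm-glued zeroN s₁ s₂ k j = refl

crossTerm-apart : ∀ ty s₁ s₂ → crossTerm ty s₁ s₂ 0 ≡ indic ty * s₁ * s₂
crossTerm-apart oneN  s₁ s₂ = cong (_* s₂) (sym (+-identityʳ s₁))
crossTerm-apart zeroN s₁ s₂ = refl

module CotreeOf {n : ℕ} (G : Graph n) (T : Cotree n) (cot : IsCotreeOf G T) where
  open ClusteringCost G
  open IsCotreeOf cot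

  adj-children : ∀ {ty l r x y} → node ty l r ⊑ T → x ∈ leaves l → y ∈ leaves r → adj G x y ≡ isOne ty
  adj-children {ty} {l} {r} {x} {y} p x∈l y∈r = by-type ty (lca-⊑ p (here-lr x∈l y∈r))
    where
    x≢y : x ≢ y
    x≢y refl = children-disjoint l r (⊑-unique p leavesUnique) x∈l y∈r
    by-type : ∀ ty′ → LcaType T x y ty′ → adj G x y ≡ isOne ty′
    by-type oneN  lca = Equivalence.from (edgesLca x y x≢y) lca
    by-type zeroN lca with adj G x y in e
    ... | false = refl
    ... | true  with lca-functional leavesUnique lca (Equivalence.to (edgesLca x y x≢y) e)
    ...   | ()

  edge-within-clade : ∀ {u z z′ y} → u ⊑ T → z ∈ leaves u → z′ ∈ leaves u → ¬ y ∈ leaves u →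
    adj G y z ≡ true → adj G y z′ ≡ true
  edge-within-clade {z = z} {z′} {y} p z∈u z′∈u y∉u yz =
    Equivalence.from (edgesLca y z′ (λ { refl → y∉u z′∈u }))
      (lca-outside p leavesUnique z∈u z′∈u y∉u (Equivalence.to (edgesLca y z (λ { refl → y∉u z∈u })) yz))

  adj-outside : ∀ {u x x′ y} → u ⊑ T → x ∈ leaves u → x′ ∈ leaves u → ¬ y ∈ leaves u → adj G y x ≡ adj G y x′
  adj-outside {u} {x} {x′} {y} p x∈u x′∈u y∉u with adj G y x in e | adj G y x′ in e′
  ... | true  | true  = refl
  ... | false | false = refl
  ... | true  | false = ⊥-elim (true≢false (trans (sym (edge-within-clade p x∈u x′∈u y∉u e)) e′))
  ... | false | true  = ⊥-elim (true≢false (trans (sym (edge-within-clade p x′∈u x∈u y∉u e′)) e))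

  module AtNode {ty : NodeType} {l r : Cotree n} (p : node ty l r ⊑ T) where

    S A B : Fin n → Bool
    S = inL (node ty l r)
    A = inL l
    B = inL r

    private
      un : Unique (leaves l ++ leaves r)
      un = ⊑-unique p leavesUnique

    S≡A∨B : ∀ i → S i ≡ A i ∨ B i
    S≡A∨B i = inList-++ (leaves l) (leaves r) i

    A∧B≡false : ∀ i → A i ∧ B i ≡ false
    A∧B≡false i with inList-cases (leaves l) i | inList-cases (leaves r) i
    ... | inj₂ (_ , e)    | _              = cong (_∧ B i) e
    ... | inj₁ (_ , e)    | inj₂ (_ , e′)  = trans (cong (_∧ B i) e) e′
    ... | inj₁ (i∈l , _)  | inj₁ (i∈r , _) = ⊥-elim (children-disjoint l r un i∈l i∈r)

    A⇒¬B : ∀ i → A i ≡ true → B i ≡ false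
    A⇒¬B i Ai = trans (sym (cong (_∧ B i) Ai)) (A∧B≡false i)

    B⇒¬A : ∀ i → B i ≡ true → A i ≡ false
    B⇒¬A i Bi = trans (sym (∧-identityʳ (A i))) (trans (cong (A i ∧_) (sym Bi)) (A∧B≡false i))

    S⇒A⊎B : ∀ i → S i ≡ true → A i ≡ true ⊎ B i ≡ true
    S⇒A⊎B i Si with A i | B i | S≡A∨B i
    ... | true  | _     | _ = inj₁ refl
    ... | false | true  | _ = inj₂ refl
    ... | false | false | e = ⊥-elim (true≢false (trans (sym Si) e))

    A⇒S : ∀ i → A i ≡ true → S i ≡ true
    A⇒S i Ai = trans (S≡A∨B i) (cong (_∨ B i) Ai)

    B⇒S : ∀ i → B i ≡ true → S i ≡ true
    B⇒S i Bi = trans (S≡A∨B i) (trans (cong (A i ∨_) Bi) (∨-zeroʳ (A i)))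

    count-A : count A ≡ size l
    count-A = count-inList (leaves l) (unique-left l r un)

    count-B : count B ≡ size r
    count-B = count-inList (leaves r) (unique-right l r un)

    adj-across : ∀ i j → A i ≡ true → B j ≡ true → adj G i j ≡ isOne ty
    adj-across i j Ai Bj = adj-children p (inList-true⁻ Ai) (inList-true⁻ Bj)

    crossTerm-unglued : crossTerm ty (size l) (size r) (count (λ i → A i ∧ false) * count (λ j → B j ∧ false)) ≡
                        indic ty * size l * size r
    crossTerm-unglued = trans (cong (λ m → crossTerm ty (size l) (size r) (m * count (λ j → B j ∧ false)))
                                    (count-zero (λ i → ∧-zeroʳ (A i))))
                              (crossTerm-apart ty (size l) (size r))

    costOn-glued : ∀ (c : Clustering n) (P Q : Fin n → Bool) → GluedAlong A B c P Q →
      costOn G S c ≡ costOn G A c + costOn G B c +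
                     crossTerm ty (size l) (size r) (count (λ i → A i ∧ P i) * count (λ j → B j ∧ Q j))
    costOn-glued c P Q glued = trans (costOn-∪ S A B c S≡A∨B A∧B≡false)
      (cong (costOn G A c + costOn G B c +_)
        (trans (crossCost-glued A B c P Q (isOne ty) adj-across glued)
               (cong (λ s → if isOne ty then s ∸ m else m) (cong₂ _*_ count-A count-B))))
      where
      m = count (λ i → A i ∧ P i) * count (λ j → B j ∧ Q j)

    clusterSize-glued-left : ∀ (c : Clustering n) (P Q : Fin n → Bool) → GluedAlong A B c P Q → ∀ v → A v ≡ true →
      clusterSize S c v ≡ clusterSize A c v + (if P v then count (λ j → B j ∧ Q j) else 0)
    clusterSize-glued-left c P Q glued v Av = trans (clusterSize-∪ S A B c v S≡A∨B A∧B≡false)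
      (cong (clusterSize A c v +_) (clusterSize-glued A B c P Q v Av glued))

    clusterSize-glued-right : ∀ (c : Clustering n) (P Q : Fin n → Bool) → GluedAlong A B c P Q → ∀ v → B v ≡ true →
      clusterSize S c v ≡ (if Q v then count (λ j → A j ∧ P j) else 0) + clusterSize B c v
    clusterSize-glued-right c P Q glued v Bv = trans (clusterSize-∪ S A B c v S≡A∨B A∧B≡false)
      (cong (_+ clusterSize B c v) (clusterSize-glued B A c Q P v Bv (GluedAlong-sym {A} {B} {c} {P} {Q} glued)))

    largest-at-node : ∀ (c : Clustering n) (sizeA sizeB : Fin n → ℕ) k →
      (∀ v → A v ≡ true → clusterSize S c v ≡ sizeA v) → (∀ v → B v ≡ true → clusterSize S c v ≡ sizeB v) →
      (∀ v → A v ≡ true → sizeA v ≤ k) → (∀ v → B v ≡ true → sizeB v ≤ k) →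
      (∃ λ v → A v ≡ true × sizeA v ≡ k) ⊎ (∃ λ v → B v ≡ true × sizeB v ≡ k) → largestCluster S c ≡ k
    largest-at-node c sizeA sizeB k eA eB boundA boundB = witnessed
      where
      bound : ∀ w → S w ≡ true → clusterSize S c w ≤ k
      bound w Sw with S⇒A⊎B w Sw
      ... | inj₁ Aw = subst (_≤ k) (sym (eA w Aw)) (boundA w Aw)
      ... | inj₂ Bw = subst (_≤ k) (sym (eB w Bw)) (boundB w Bw)
      witnessed : (∃ λ v → A v ≡ true × sizeA v ≡ k) ⊎ (∃ λ v → B v ≡ true × sizeB v ≡ k) → largestCluster S c ≡ k
      witnessed (inj₁ (v , Av , e)) = largest≡ S c k v bound (A⇒S v Av) (trans (eA v Av) e)
      witnessed (inj₂ (v , Bv , e)) = largest≡ S c k v bound (B⇒S v Bv) (trans (eB v Bv) e)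

    combine : ∀ {J₁ J₂} → Merging J₁ J₂ → Clustering n → Clustering n → Clustering n
    combine M c₁ c₂ x = if A x then code₁ (c₁ x) else code₂ (c₂ x)
      where open Merging M

    module _ {J₁ J₂ : ℕ → Bool} (M : Merging J₁ J₂) (c₁ c₂ : Clustering n) where
      open Merging M

      private
        c : Clustering n
        c = combine M c₁ c₂

        c-left : ∀ x → A x ≡ true → c x ≡ code₁ (c₁ x)
        c-left x Ax = cong (λ b → if b then code₁ (c₁ x) else code₂ (c₂ x)) Ax

        c-right : ∀ x → B x ≡ true → c x ≡ code₂ (c₂ x)
        c-right x Bx = cong (λ b → if b then code₁ (c₁ x) else code₂ (c₂ x)) (B⇒¬A x Bx)

        glued : GluedAlong A B c (J₁ ∘ c₁) (J₂ ∘ c₂)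
        glued i j Ai Bj rewrite c-left i Ai | c-right j Bj = code-meet (c₁ i) (c₂ j)

        same-left : ∀ i j → A i ≡ true → A j ≡ true → (c i ≡ᵇ c j) ≡ (c₁ i ≡ᵇ c₁ j)
        same-left i j Ai Aj rewrite c-left i Ai | c-left j Aj = ≡ᵇ-preserved code₁ code₁-injective (c₁ i) (c₁ j)

        same-right : ∀ i j → B i ≡ true → B j ≡ true → (c i ≡ᵇ c j) ≡ (c₂ i ≡ᵇ c₂ j)
        same-right i j Bi Bj rewrite c-right i Bi | c-right j Bj = ≡ᵇ-preserved code₂ code₂-injective (c₂ i) (c₂ j)

      costOn-combine : costOn G S c ≡ costOn G A c₁ + costOn G B c₂ +
        crossTerm ty (size l) (size r) (count (λ i → A i ∧ J₁ (c₁ i)) * count (λ j → B j ∧ J₂ (c₂ j)))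
      costOn-combine = trans (costOn-glued c (J₁ ∘ c₁) (J₂ ∘ c₂) glued)
        (cong₂ (λ x y → x + y + _) (costOn-cong A c c₁ same-left) (costOn-cong B c c₂ same-right))

      clusterSize-combine-left : ∀ v → A v ≡ true →
        clusterSize S c v ≡ clusterSize A c₁ v + (if J₁ (c₁ v) then count (λ j → B j ∧ J₂ (c₂ j)) else 0)
      clusterSize-combine-left v Av = trans (clusterSize-glued-left c (J₁ ∘ c₁) (J₂ ∘ c₂) glued v Av)
        (cong (_+ _) (clusterSize-cong A c c₁ v (λ w Aw → same-left w v Aw Av)))

      clusterSize-combine-right : ∀ v → B v ≡ true →
        clusterSize S c v ≡ (if J₂ (c₂ v) then count (λ j → A j ∧ J₁ (c₁ j)) else 0) + clusterSize B c₂ v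
      clusterSize-combine-right v Bv = trans (clusterSize-glued-right c (J₁ ∘ c₁) (J₂ ∘ c₂) glued v Bv)
        (cong (_ +_) (clusterSize-cong B c c₂ v (λ w Bw → same-right w v Bw Bv)))

  Achievable : Cotree n → ℕ → ℕ → Set
  Achievable u k d = ∃ λ (c : Clustering n) → costOn G (inL u) c ≤ d × largestCluster (inL u) c ≡ k

  achievable-weaken : ∀ {u k d d′} → d ≤ d′ → Achievable u k d → Achievable u k d′
  achievable-weaken d≤d′ (c , cost≤d , largest≡k) = c , ≤-trans cost≤d d≤d′ , largest≡k

  largest-clade-pos : ∀ (u : Cotree n) (c : Clustering n) → 1 ≤ largestCluster (inL u) c
  largest-clade-pos u c with leaves-nonempty u
  ... | x , x∈u = largest-pos (inL u) c x (inList-true x∈u)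

  largest-clade-attained : ∀ (u : Cotree n) (c : Clustering n) →
    ∃ λ v → inL u v ≡ true × clusterSize (inL u) c v ≡ largestCluster (inL u) c
  largest-clade-attained u c = largest-attained (inL u) c (largest-clade-pos u c)

  module _ {ty : NodeType} {l r : Cotree n} (p : node ty l r ⊑ T) where
    open AtNode p

    achievable-apart : ∀ {k₁ k₂ d₁ d₂} k → Achievable l k₁ d₁ → Achievable r k₂ d₂ → k₁ ≤ k → k₂ ≤ k → k₁ ≡ k ⊎ k₂ ≡ k →
      Achievable (node ty l r) k (d₁ + d₂ + indic ty * size l * size r)
    achievable-apart {k₁} {k₂} {d₁} {d₂} k (c₁ , cost₁ , largest₁) (c₂ , cost₂ , largest₂) k₁≤k k₂≤k k₁≡k⊎k₂≡k =
      c , cost≤ , largest-at-node c (clusterSize A c₁) (clusterSize B c₂) k size-left size-right bound₁ bound₂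
                    (attained k₁≡k⊎k₂≡k)
      where
      c = combine keepApart c₁ c₂
      cost≤ : costOn G S c ≤ d₁ + d₂ + indic ty * size l * size r
      cost≤ = begin
          costOn G S c
        ≡⟨ costOn-combine keepApart c₁ c₂ ⟩
          costOn G A c₁ + costOn G B c₂ + crossTerm ty (size l) (size r) (count (λ i → A i ∧ false) * count (λ j → B j ∧ false))
        ≡⟨ cong (costOn G A c₁ + costOn G B c₂ +_) crossTerm-unglued ⟩
          costOn G A c₁ + costOn G B c₂ + indic ty * size l * size r
        ≤⟨ +-monoˡ-≤ _ (+-mono-≤ cost₁ cost₂) ⟩
          d₁ + d₂ + indic ty * size l * size r
        ∎
        where open ≤-Reasoning
      size-left : ∀ v → A v ≡ true → clusterSize S c v ≡ clusterSize A c₁ v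
      size-left v Av = trans (clusterSize-combine-left keepApart c₁ c₂ v Av) (+-identityʳ _)
      size-right : ∀ v → B v ≡ true → clusterSize S c v ≡ clusterSize B c₂ v
      size-right = clusterSize-combine-right keepApart c₁ c₂
      bound₁ : ∀ v → A v ≡ true → clusterSize A c₁ v ≤ k
      bound₁ v Av = ≤-trans (subst (clusterSize A c₁ v ≤_) largest₁ (clusterSize≤largest A c₁ v Av)) k₁≤k
      bound₂ : ∀ v → B v ≡ true → clusterSize B c₂ v ≤ k
      bound₂ v Bv = ≤-trans (subst (clusterSize B c₂ v ≤_) largest₂ (clusterSize≤largest B c₂ v Bv)) k₂≤k
      attained : k₁ ≡ k ⊎ k₂ ≡ k →
        (∃ λ v → A v ≡ true × clusterSize A c₁ v ≡ k) ⊎ (∃ λ v → B v ≡ true × clusterSize B c₂ v ≡ k)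
      attained (inj₁ k₁≡k) with largest-clade-attained l c₁
      ... | v , Av , e = inj₁ (v , Av , trans e (trans largest₁ k₁≡k))
      attained (inj₂ k₂≡k) with largest-clade-attained r c₂
      ... | v , Bv , e = inj₂ (v , Bv , trans e (trans largest₂ k₂≡k))

    -- a largest cluster of each side is merged into one cluster of size j + (k ∸ j) = k
    achievable-glued : ∀ j k {d₁ d₂} → j ≤ k → Achievable l j d₁ → Achievable r (k ∸ j) d₂ →
      Achievable (node ty l r) k (d₁ + d₂ + alpha ty (size l) (size r) k j)
    achievable-glued j k {d₁} {d₂} j≤k (c₁ , cost₁ , largest₁) (c₂ , cost₂ , largest₂)
      with largest-clade-attained l c₁ | largest-clade-attained r c₂
    ... | v₁ , Av₁ , size-v₁ | v₂ , _ , size-v₂ =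
      c , cost≤ , largest-at-node c size₁ size₂ k (clusterSize-combine-left M c₁ c₂) (clusterSize-combine-right M c₁ c₂)
                    bound₁ bound₂ (inj₁ (v₁ , Av₁ , size₁-v₁))
      where
      ℓ₁ = c₁ v₁
      ℓ₂ = c₂ v₂
      M = mergeAt ℓ₁ ℓ₂
      c = combine M c₁ c₂
      part₁ part₂ : ℕ
      part₁ = count (λ i → A i ∧ (c₁ i ≡ᵇ ℓ₁))
      part₂ = count (λ i → B i ∧ (c₂ i ≡ᵇ ℓ₂))
      part₁≡j : part₁ ≡ j
      part₁≡j = trans size-v₁ largest₁
      part₂≡k∸j : part₂ ≡ k ∸ j
      part₂≡k∸j = trans size-v₂ largest₂
      j+[k∸j]≡k : j + (k ∸ j) ≡ k
      j+[k∸j]≡k = m+[n∸m]≡n j≤k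
      cost≤ : costOn G S c ≤ d₁ + d₂ + alpha ty (size l) (size r) k j
      cost≤ = begin
          costOn G S c
        ≡⟨ costOn-combine M c₁ c₂ ⟩
          costOn G A c₁ + costOn G B c₂ + crossTerm ty (size l) (size r) (part₁ * part₂)
        ≡⟨ cong (λ m → costOn G A c₁ + costOn G B c₂ + crossTerm ty (size l) (size r) m) (cong₂ _*_ part₁≡j part₂≡k∸j) ⟩
          costOn G A c₁ + costOn G B c₂ + crossTerm ty (size l) (size r) (j * (k ∸ j))
        ≡⟨ cong (costOn G A c₁ + costOn G B c₂ +_) (crossTerm-glued ty (size l) (size r) k j) ⟩
          costOn G A c₁ + costOn G B c₂ + alpha ty (size l) (size r) k j
        ≤⟨ +-monoˡ-≤ _ (+-mono-≤ cost₁ cost₂) ⟩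
          d₁ + d₂ + alpha ty (size l) (size r) k j
        ∎
        where open ≤-Reasoning
      size₁ size₂ : Fin n → ℕ
      size₁ v = clusterSize A c₁ v + (if c₁ v ≡ᵇ ℓ₁ then part₂ else 0)
      size₂ v = (if c₂ v ≡ᵇ ℓ₂ then part₁ else 0) + clusterSize B c₂ v
      bound₁ : ∀ v → A v ≡ true → size₁ v ≤ k
      bound₁ v Av with ≡ᵇ-cases (c₁ v) ℓ₁
      ... | inj₁ (same , e) rewrite e =
        ≤-reflexive (trans (cong₂ _+_ (trans (clusterSize-label A c₁ v v₁ same) part₁≡j) part₂≡k∸j) j+[k∸j]≡k)
      ... | inj₂ (_ , e) rewrite e =
        ≤-trans (≤-reflexive (+-identityʳ _)) (≤-trans (subst (clusterSize A c₁ v ≤_) largest₁ (clusterSize≤largest A c₁ v Av)) j≤k)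
      bound₂ : ∀ v → B v ≡ true → size₂ v ≤ k
      bound₂ v Bv with ≡ᵇ-cases (c₂ v) ℓ₂
      ... | inj₁ (same , e) rewrite e =
        ≤-reflexive (trans (cong₂ _+_ part₁≡j (trans (clusterSize-label B c₂ v v₂ same) part₂≡k∸j)) j+[k∸j]≡k)
      ... | inj₂ (_ , e) rewrite e =
        ≤-trans (subst (clusterSize B c₂ v ≤_) largest₂ (clusterSize≤largest B c₂ v Bv)) (m∸n≤m k j)
      size₁-v₁ : size₁ v₁ ≡ k
      size₁-v₁ rewrite ≡ᵇ-refl ℓ₁ = trans (cong₂ _+_ part₁≡j part₂≡k∸j) j+[k∸j]≡k

    module _ (ih-l : ∀ k d → D l k ≡ just d → Achievable l k d) (ih-r : ∀ k d → D r k ≡ just d → Achievable r k d) where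

      private
        I = indic ty * size l * size r

      from-left-largest : ∀ k d → D l k ⊕ minTo k (D r) ⊕ just I ≡ just d → Achievable (node ty l r) k d
      from-left-largest k d e with ⊕-just⁻ (D l k ⊕ minTo k (D r)) (just I) e
      ... | a , _ , ea , refl , refl with ⊕-just⁻ (D l k) (minTo k (D r)) ea
      ...   | a₁ , m , el , em , refl with minTo-attained k (D r) em
      ...     | j , _ , j≤k , er = achievable-apart k (ih-l k a₁ el) (ih-r j m er) ≤-refl j≤k (inj₁ refl)

      from-right-largest : ∀ k d → D r k ⊕ minTo k (D l) ⊕ just I ≡ just d → Achievable (node ty l r) k d
      from-right-largest k d e with ⊕-just⁻ (D r k ⊕ minTo k (D l)) (just I) e
      ... | a , _ , ea , refl , refl with ⊕-just⁻ (D r k) (minTo k (D l)) ea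
      ...   | a₂ , m , er , em , refl with minTo-attained k (D l) em
      ...     | j , _ , j≤k , el = achievable-weaken {node ty l r} (≤-reflexive (cong (_+ I) (+-comm m a₂)))
                                     (achievable-apart k (ih-l j m el) (ih-r k a₂ er) j≤k ≤-refl (inj₂ refl))

      from-glued : ∀ k d → minTo (k ∸ 1) (λ j → D l j ⊕ D r (k ∸ j) ⊕ just (alpha ty (size l) (size r) k j)) ≡ just d →
        Achievable (node ty l r) k d
      from-glued k d e with minTo-attained (k ∸ 1) _ e
      ... | j , _ , j≤k∸1 , ej with ⊕-just⁻ (D l j ⊕ D r (k ∸ j)) _ ej
      ...   | a , _ , ea , refl , refl with ⊕-just⁻ (D l j) (D r (k ∸ j)) ea
      ...     | a₁ , a₂ , el , er , refl =
        achievable-glued j k (≤-trans j≤k∸1 (m∸n≤m k 1)) (ih-l j a₁ el) (ih-r (k ∸ j) a₂ er)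

      D-node-sound : ∀ k d → D (node ty l r) k ≡ just d → Achievable (node ty l r) k d
      D-node-sound k d e with ⊓∞-sel (D l k ⊕ minTo k (D r) ⊕ just I ⊓∞ D r k ⊕ minTo k (D l) ⊕ just I) _ e
      ... | inj₂ e₃ = from-glued k d e₃
      ... | inj₁ e′ with ⊓∞-sel (D l k ⊕ minTo k (D r) ⊕ just I) (D r k ⊕ minTo k (D l) ⊕ just I) e′
      ...   | inj₁ e₁ = from-left-largest k d e₁
      ...   | inj₂ e₂ = from-right-largest k d e₂

  D-sound : ∀ u → u ⊑ T → ∀ k d → D u k ≡ just d → Achievable u k d
  D-sound (leaf x)      p zero          d ()
  D-sound (leaf x)      p (suc (suc k)) d ()
  D-sound (leaf x)      p 1             d refl = (λ _ → 0) , ≤-reflexive (costOn-leaf x (λ _ → 0)) , largest-leaf x (λ _ → 0)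
  D-sound (node ty l r) p = D-node-sound p (D-sound l (⊑-trans (left here) p)) (D-sound r (⊑-trans (right here) p))

-- Exchanging a clustering inside a module

module InsideModule {n : ℕ} (G : Graph n) (X : Fin n → Bool) (x₀ : Fin n)
  (adj-uniform : ∀ y x → X y ≡ false → X x ≡ true → adj G y x ≡ adj G y x₀) where
  open ClusteringCost G

  outCost : Clustering n → Fin n → ℕ
  outCost c y = count (λ x → not (X y) ∧ X x ∧ badPair G c y x)

  outCostOn : (Fin n → Bool) → Clustering n → ℕ
  outCostOn Z c = ∑ᶠ (λ y → if Z y then outCost c y else 0)

  cost-split : ∀ c → cost G c ≡ costOn G X c + costOn G (not ∘ X) c + ∑ᶠ (outCost c)
  cost-split c = trans (costOn-∪ (λ _ → true) X (not ∘ X) c (λ i → sym (∨-inverseʳ (X i))) (λ i → ∧-inverseʳ (X i)))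
                       (cong (costOn G X c + costOn G (not ∘ X) c +_) (crossCost-sym X (not ∘ X) c))

  outCost-inside : ∀ c y → X y ≡ true → outCost c y ≡ 0
  outCost-inside c y Xy = count-zero (λ x → false-∧ {b = X x ∧ badPair G c y x} (cong not Xy))

  -- all of X looks the same from y, so only the part of y's cluster inside X matters
  outCost-outside : ∀ c y → X y ≡ false →
    outCost c y ≡ (if adj G y x₀ then count X ∸ clusterSize X c y else clusterSize X c y)
  outCost-outside c y Xy = trans (count-cong bad≡) (by-adjacency (adj G y x₀))
    where
    together : Fin n → Bool
    together x = c x ≡ᵇ c y
    bad≡ : ∀ x → not (X y) ∧ X x ∧ badPair G c y x ≡ X x ∧ (if adj G y x₀ then not (together x) else together x)
    bad≡ x with X x in eX
    ... | false rewrite Xy = refl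
    ... | true  rewrite Xy | adj-uniform y x Xy eX | ≡ᵇ-sym (c y) (c x) = refl
    by-adjacency : ∀ b → count (λ x → X x ∧ (if b then not (together x) else together x)) ≡
                         (if b then count X ∸ clusterSize X c y else clusterSize X c y)
    by-adjacency true  = sym (trans (cong (_∸ clusterSize X c y) (count-split X together))
                                    (m+n∸m≡n (clusterSize X c y) _))
    by-adjacency false = refl

  cost-exchange : ∀ (c c′ : Clustering n) (Z : Fin n → Bool) →
    (∀ z → X z ≡ false → c z ≡ c′ z) →
    (∀ y → X y ≡ false → Z y ≡ false → clusterSize X c y ≡ clusterSize X c′ y) →
    cost G c + outCostOn Z c′ + costOn G X c′ ≡ cost G c′ + outCostOn Z c + costOn G X c
  cost-exchange c c′ Z agree same-size = begin
      cost G c + outCostOn Z c′ + costOn G X c′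
    ≡⟨ cong (λ z → z + outCostOn Z c′ + costOn G X c′) (cost-split c) ⟩
      costOn G X c + costOn G (not ∘ X) c + ∑ᶠ (outCost c) + outCostOn Z c′ + costOn G X c′
    ≡⟨ rearrange (costOn G X c) (costOn G (not ∘ X) c) (costOn G X c′) out-swap ⟩
      costOn G X c′ + costOn G (not ∘ X) c + ∑ᶠ (outCost c′) + outCostOn Z c + costOn G X c
    ≡⟨ cong (λ z → costOn G X c′ + z + ∑ᶠ (outCost c′) + outCostOn Z c + costOn G X c) outside-same ⟩
      costOn G X c′ + costOn G (not ∘ X) c′ + ∑ᶠ (outCost c′) + outCostOn Z c + costOn G X c
    ≡⟨ cong (λ z → z + outCostOn Z c + costOn G X c) (sym (cost-split c′)) ⟩
      cost G c′ + outCostOn Z c + costOn G X c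
    ∎
    where
    open ≡-Reasoning
    rearrange : ∀ x o x′ {s w s′ w′} → s + w′ ≡ s′ + w → x + o + s + w′ + x′ ≡ x′ + o + s′ + w + x
    rearrange x o x′ {s} {w} {s′} {w′} e = begin
        x + o + s + w′ + x′   ≡⟨ solve 5 (λ x o s w′ x′ → x :+ o :+ s :+ w′ :+ x′ := (x :+ o :+ x′) :+ (s :+ w′)) refl x o s w′ x′ ⟩
        (x + o + x′) + (s + w′) ≡⟨ cong ((x + o + x′) +_) e ⟩
        (x + o + x′) + (s′ + w) ≡⟨ solve 5 (λ x o x′ s′ w → (x :+ o :+ x′) :+ (s′ :+ w) := x′ :+ o :+ s′ :+ w :+ x) refl x o x′ s′ w ⟩
        x′ + o + s′ + w + x   ∎
      where open +-*-Solver
    outside-same : costOn G (not ∘ X) c ≡ costOn G (not ∘ X) c′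
    outside-same = costOn-cong (not ∘ X) c c′ (λ i j ¬Xi ¬Xj →
      cong₂ _≡ᵇ_ (agree i (not-injective ¬Xi)) (agree j (not-injective ¬Xj)))
    outCost-same : ∀ y → Z y ≡ false → outCost c y ≡ outCost c′ y
    outCost-same y Zy with bool-cases (X y)
    ... | inj₁ eX = trans (outCost-inside c y eX) (sym (outCost-inside c′ y eX))
    ... | inj₂ eX = trans (outCost-outside c y eX)
                    (trans (cong (λ t → if adj G y x₀ then count X ∸ t else t) (same-size y eX Zy))
                           (sym (outCost-outside c′ y eX)))
    pointwise : ∀ y → outCost c y + (if Z y then outCost c′ y else 0) ≡ outCost c′ y + (if Z y then outCost c y else 0)
    pointwise y with Z y in eZ
    ... | true  = +-comm (outCost c y) (outCost c′ y)
    ... | false = cong (_+ 0) (outCost-same y eZ)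
    out-swap : ∑ᶠ (outCost c) + outCostOn Z c′ ≡ ∑ᶠ (outCost c′) + outCostOn Z c
    out-swap = trans (sym (∑-+ (allFin n) (outCost c) (λ y → if Z y then outCost c′ y else 0)))
                 (trans (∑-cong (allFin n) pointwise) (∑-+ (allFin n) (outCost c′) (λ y → if Z y then outCost c y else 0)))

  cost-exchange-exact : ∀ (c c′ : Clustering n) → (∀ z → X z ≡ false → c z ≡ c′ z) →
    (∀ y → X y ≡ false → clusterSize X c y ≡ clusterSize X c′ y) →
    cost G c + costOn G X c′ ≡ cost G c′ + costOn G X c
  cost-exchange-exact c c′ agree same-size = begin
      cost G c + costOn G X c′                ≡⟨ cong (λ z → z + costOn G X c′) (sym (+-identityʳ (cost G c))) ⟩
      cost G c + 0 + costOn G X c′            ≡⟨ cong (λ z → cost G c + z + costOn G X c′) (sym (nothing-outside c′)) ⟩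
      cost G c + outCostOn none c′ + costOn G X c′
        ≡⟨ cost-exchange c c′ none agree (λ y Xy _ → same-size y Xy) ⟩
      cost G c′ + outCostOn none c + costOn G X c ≡⟨ cong (λ z → cost G c′ + z + costOn G X c) (nothing-outside c) ⟩
      cost G c′ + 0 + costOn G X c            ≡⟨ cong (λ z → z + costOn G X c) (+-identityʳ (cost G c′)) ⟩
      cost G c′ + costOn G X c                ∎
    where
    open ≡-Reasoning
    none : Fin n → Bool
    none _ = false
    nothing-outside : ∀ c → outCostOn none c ≡ 0
    nothing-outside _ = ∑-zero (allFin n) (λ _ → refl)

  outCostOn-uniform : ∀ (Z : Fin n → Bool) (c : Clustering n) t → (∀ y → Z y ≡ true → X y ≡ false) →
    (∀ y → Z y ≡ true → clusterSize X c y ≡ t) →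
    outCostOn Z c ≡ count (λ y → Z y ∧ adj G y x₀) * (count X ∸ t) + count (λ y → Z y ∧ not (adj G y x₀)) * t
  outCostOn-uniform Z c t Z⇒¬X size≡t = trans (∑-cong (allFin n) pointwise)
    (trans (∑-+ (allFin n) (λ y → χ (Z y ∧ adj G y x₀) * (count X ∸ t)) (λ y → χ (Z y ∧ not (adj G y x₀)) * t))
      (cong₂ _+_ (∑-*ʳ (allFin n) (count X ∸ t) (λ y → χ (Z y ∧ adj G y x₀)))
                 (∑-*ʳ (allFin n) t (λ y → χ (Z y ∧ not (adj G y x₀))))))
    where
    pointwise : ∀ y → (if Z y then outCost c y else 0) ≡ χ (Z y ∧ adj G y x₀) * (count X ∸ t) + χ (Z y ∧ not (adj G y x₀)) * t
    pointwise y with Z y in eZ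
    ... | false = refl
    ... | true rewrite outCost-outside c y (Z⇒¬X y eZ) | size≡t y eZ with adj G y x₀
    ...   | true  = sym (trans (+-identityʳ _) (+-identityʳ _))
    ...   | false = sym (+-identityʳ t)

any-witness : ∀ {A : Set} (p : A → Bool) (xs : List A) → any p xs ≡ true → ∃ λ x → p x ≡ true
any-witness p xs e with satisfied (any⁻ p xs (Equivalence.from T-≡ e))
... | x , px = x , Equivalence.to T-≡ px

any-intro : ∀ {A : Set} (p : A → Bool) {xs : List A} {x} → x ∈ xs → p x ≡ true → any p xs ≡ true
any-intro p x∈xs px = Equivalence.to T-≡ (any⁺ p (AnyP.map (λ { refl → Equivalence.from T-≡ px }) x∈xs))

shared-cluster? : ∀ {n} (P Q : Fin n → Bool) (c : Clustering n) →
  (∃ λ x → ∃ λ y → P x ≡ true × Q y ≡ true × c x ≡ c y) ⊎ (∀ x y → P x ≡ true → Q y ≡ true → c x ≢ c y)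
shared-cluster? {n} P Q c with any (λ x → P x ∧ any (λ y → Q y ∧ (c x ≡ᵇ c y)) (allFin n)) (allFin n) in e
... | true with any-witness _ (allFin n) e
...   | x , ex with any-witness _ (allFin n) (∧-conicalʳ (P x) _ ex)
...     | y , ey = inj₁ (x , y , ∧-conicalˡ _ _ ex , ∧-conicalˡ _ _ ey , ≡ᵇ-sound (∧-conicalʳ (Q y) _ ey))
shared-cluster? {n} P Q c | false = inj₂ none
  where
  none : ∀ x y → P x ≡ true → Q y ≡ true → c x ≢ c y
  none x y Px Qy same = true≢false (trans (sym (any-intro _ (∈-allFin x)
    (trans (cong (_∧ any (λ y → Q y ∧ (c x ≡ᵇ c y)) (allFin n)) Px)
           (any-intro _ (∈-allFin y) (trans (cong (_∧ (c x ≡ᵇ c y)) Qy) (≡ᵇ-true same)))))) e)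

module _ {n : ℕ} where

  -- numClusters c is count (isFirst c)
  isFirst : Clustering n → Fin n → Bool
  isFirst c v = not (any (λ w → before w v ∧ (c w ≡ᵇ c v)) (allFin n))

  isFirst-false : ∀ c v w → before w v ≡ true → c w ≡ c v → isFirst c v ≡ false
  isFirst-false c v w w<v same = cong not (any-intro _ (∈-allFin w) (trans (cong (_∧ (c w ≡ᵇ c v)) w<v) (≡ᵇ-true same)))

  isFirst-true : ∀ c v → (∀ w → before w v ≡ true → c w ≢ c v) → isFirst c v ≡ true
  isFirst-true c v none with any (λ w → before w v ∧ (c w ≡ᵇ c v)) (allFin n) in e
  ... | false = refl
  ... | true with any-witness _ (allFin n) e
  ...   | w , ew = ⊥-elim (none w (∧-conicalˡ _ _ ew) (≡ᵇ-sound (∧-conicalʳ _ _ ew)))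

  isFirst-true⁻ : ∀ c v → isFirst c v ≡ true → ∀ w → before w v ≡ true → c w ≢ c v
  isFirst-true⁻ c v first w w<v same = true≢false (trans (sym first) (isFirst-false c v w w<v same))

  least-satisfying : ∀ (P : Fin n → Bool) x → P x ≡ true → ∃ λ m → P m ≡ true × (∀ w → before w m ≡ true → P w ≡ false)
  least-satisfying P x Px = below (suc (toℕ x)) x ≤-refl Px
    where
    below : ∀ k x → toℕ x < k → P x ≡ true → ∃ λ m → P m ≡ true × (∀ w → before w m ≡ true → P w ≡ false)
    below (suc k) x (s≤s x≤k) Px with any (λ w → before w x ∧ P w) (allFin n) in e
    ... | false = x , Px , least
      where
      least : ∀ w → before w x ≡ true → P w ≡ false
      least w w<x with P w in ePw
      ... | false = refl
      ... | true  = ⊥-elim (true≢false (trans (sym (any-intro _ (∈-allFin w) (trans (cong (_∧ P w) w<x) ePw))) e))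
    ... | true with any-witness _ (allFin n) e
    ...   | w , ew = below k w (≤-trans (<ᵇ⇒< (toℕ w) (toℕ x) (Equivalence.from T-≡ (∧-conicalˡ _ _ ew))) x≤k)
                             (∧-conicalʳ _ _ ew)

  numClusters-split : ∀ (c : Clustering n) (Moved : Fin n → Bool) (M ℓ : ℕ) →
    (∀ z → c z ≢ M) → (∀ z → Moved z ≡ true → c z ≡ ℓ) →
    ∀ x₀ y₀ → Moved x₀ ≡ true → Moved y₀ ≡ false → c y₀ ≡ ℓ →
    numClusters c < numClusters (λ z → if Moved z then M else c z)
  numClusters-split c Moved M ℓ unused moved-ℓ x₀ y₀ Mx₀ My₀ cy₀
    with least-satisfying Moved x₀ Mx₀
       | least-satisfying (λ z → not (Moved z) ∧ (c z ≡ᵇ ℓ)) y₀ (trans (cong (λ b → not b ∧ (c y₀ ≡ᵇ ℓ)) My₀) (≡ᵇ-true cy₀))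
  ... | m₁ , Mm₁ , least₁ | m₂ , Pm₂ , least₂ = ∑-mono-< (∈-allFin v) more-first new-first
    where
    c′ : Clustering n
    c′ z = if Moved z then M else c z
    c′-moved : ∀ z → Moved z ≡ true → c′ z ≡ M
    c′-moved z e = cong (λ b → if b then M else c z) e
    c′-kept : ∀ z → Moved z ≡ false → c′ z ≡ c z
    c′-kept z e = cong (λ b → if b then M else c z) e
    still-first : ∀ v → isFirst c v ≡ true → isFirst c′ v ≡ true
    still-first v first = isFirst-true c′ v distinct
      where
      distinct : ∀ w → before w v ≡ true → c′ w ≢ c′ v
      distinct w w<v same with bool-cases (Moved v) | bool-cases (Moved w)
      ... | inj₁ Mv | inj₁ Mw = isFirst-true⁻ c v first w w<v (trans (moved-ℓ w Mw) (sym (moved-ℓ v Mv)))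
      ... | inj₁ Mv | inj₂ Mw = unused w (trans (sym (c′-kept w Mw)) (trans same (c′-moved v Mv)))
      ... | inj₂ Mv | inj₁ Mw = unused v (trans (sym (c′-kept v Mv)) (trans (sym same) (c′-moved w Mw)))
      ... | inj₂ Mv | inj₂ Mw = isFirst-true⁻ c v first w w<v (trans (sym (c′-kept w Mw)) (trans same (c′-kept v Mv)))
    more-first : ∀ v → χ (isFirst c v) ≤ χ (isFirst c′ v)
    more-first v with isFirst c v in e
    ... | true rewrite still-first v e = ≤-refl
    ... | false = z≤n
    Mm₂ : Moved m₂ ≡ false
    Mm₂ = not-injective (∧-conicalˡ _ _ Pm₂)
    cm₂ : c m₂ ≡ ℓ
    cm₂ = ≡ᵇ-sound (∧-conicalʳ (not (Moved m₂)) _ Pm₂)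
    m₁≢m₂ : m₁ ≢ m₂
    m₁≢m₂ e = true≢false (trans (sym Mm₁) (trans (cong Moved e) Mm₂))
    -- the later of m₁ and m₂ becomes the first vertex of its cluster
    v : Fin n
    v with before-connex m₁ m₂ m₁≢m₂
    ... | inj₁ _ = m₂
    ... | inj₂ _ = m₁
    first-m₂ : ∀ w → before w m₂ ≡ true → c′ w ≢ c′ m₂
    first-m₂ w w<m₂ same with bool-cases (Moved w)
    ... | inj₁ Mw = unused m₂ (trans (sym (c′-kept m₂ Mm₂)) (trans (sym same) (c′-moved w Mw)))
    ... | inj₂ Mw = true≢false (trans (sym (trans (cong (λ b → not b ∧ (c w ≡ᵇ ℓ)) Mw)
                      (≡ᵇ-true (trans (sym (c′-kept w Mw)) (trans same (trans (c′-kept m₂ Mm₂) cm₂)))))) (least₂ w w<m₂))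
    first-m₁ : ∀ w → before w m₁ ≡ true → c′ w ≢ c′ m₁
    first-m₁ w w<m₁ same with bool-cases (Moved w)
    ... | inj₁ Mw = true≢false (trans (sym Mw) (least₁ w w<m₁))
    ... | inj₂ Mw = unused w (trans (sym (c′-kept w Mw)) (trans same (c′-moved m₁ Mm₁)))
    new-first : χ (isFirst c v) < χ (isFirst c′ v)
    new-first with before-connex m₁ m₂ m₁≢m₂
    ... | inj₁ (m₁<m₂ , _) rewrite isFirst-false c m₂ m₁ m₁<m₂ (trans (moved-ℓ m₁ Mm₁) (sym cm₂)) | isFirst-true c′ m₂ first-m₂ = ≤-refl
    ... | inj₂ (_ , m₂<m₁) rewrite isFirst-false c m₁ m₂ m₂<m₁ (trans cm₂ (sym (moved-ℓ m₁ Mm₁))) | isFirst-true c′ m₁ first-m₁ = ≤-refl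

-- Well-behaved clusterings

p*x+q*a≤p*[x+a]⇒q≤p : ∀ p q x a → 1 ≤ a → p * x + q * a ≤ p * (x + a) → q ≤ p
p*x+q*a≤p*[x+a]⇒q≤p p q x (suc a) _ le = *-cancelʳ-≤ q p (suc a)
  (+-cancelˡ-≤ (p * x) (q * suc a) (p * suc a) (subst (p * x + q * suc a ≤_) (*-distribˡ-+ p x (suc a)) le))

p*[e+d]+q*a≤p*e+q*[a+d]⇒p≤q : ∀ p q e d a → 1 ≤ d → p * (e + d) + q * a ≤ p * e + q * (a + d) → p ≤ q
p*[e+d]+q*a≤p*e+q*[a+d]⇒p≤q p q e (suc d) a _ le = *-cancelʳ-≤ p q (suc d)
  (+-cancelʳ-≤ (q * a) (p * suc d) (q * suc d) (+-cancelˡ-≤ (p * e) _ _ (subst₂ _≤_ lhs rhs le)))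
  where
  open +-*-Solver
  lhs : p * (e + suc d) + q * a ≡ p * e + (p * suc d + q * a)
  lhs = solve 5 (λ p e d q a → p :* (e :+ d) :+ q :* a := p :* e :+ (p :* d :+ q :* a)) refl p e (suc d) q a
  rhs : p * e + q * (a + suc d) ≡ p * e + (q * suc d + q * a)
  rhs = solve 5 (λ p e d q a → p :* e :+ q :* (a :+ d) := p :* e :+ (q :* d :+ q :* a)) refl p e (suc d) q a

module WellBehavedClustering {n : ℕ} (G : Graph n) (T : Cotree n) (cot : IsCotreeOf G T)
  (𝒞 : Clustering n) (wb : WellBehaved G T 𝒞) where
  open ClusteringCost G
  open CotreeOf G T cot
  open IsCotreeOf cot using (leavesUnique)

  optimal : Optimal G 𝒞
  optimal = proj₁ wb

  single-growth : AllSingleGrowth T 𝒞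
  single-growth = proj₁ (proj₂ wb)

  most-clusters : ∀ c → Optimal G c → AllSingleGrowth T c → numClusters c ≤ numClusters 𝒞
  most-clusters = proj₂ (proj₂ wb)

  unused : ℕ
  unused = suc (∑ᶠ 𝒞)

  label<unused : ∀ z → 𝒞 z < unused
  label<unused z = s≤s (term≤∑ 𝒞 (∈-allFin z))

  adj-uniform : ∀ {u} → u ⊑ T → ∀ x₀ → inL u x₀ ≡ true →
    ∀ y x → inL u y ≡ false → inL u x ≡ true → adj G y x ≡ adj G y x₀
  adj-uniform pu x₀ x₀∈u y x y∉u x∈u = adj-outside pu (inList-true⁻ x∈u) (inList-true⁻ x₀∈u) (inList-false⁻ y∉u)

  -- If the clade X grows in the cluster ℓ of x₀, let Z be the part of ℓ outside X, p and q the numbers of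
  -- vertices of Z adjacent and non-adjacent to X. Re-attaching Z to a cluster of size t inside X costs
  -- p (|X| - t) + q t, so optimality forces p = q as soon as some cluster inside X is larger than ℓ ∩ X;
  -- but then splitting ℓ ∩ X off from Z is also optimal and has more clusters.
  module GrowingClade {u : Cotree n} (pu : u ⊑ T) (x₀ y₀ : Fin n)
    (x₀∈u : inL u x₀ ≡ true) (y₀∉u : inL u y₀ ≡ false) (x₀~y₀ : 𝒞 x₀ ≡ 𝒞 y₀) where

    X : Fin n → Bool
    X = inL u

    open InsideModule G X x₀ (adj-uniform pu x₀ x₀∈u)

    ℓ = 𝒞 x₀
    a = clusterSize X 𝒞 x₀
    N = count X

    Z : Fin n → Bool
    Z y = not (X y) ∧ (𝒞 y ≡ᵇ ℓ)

    p q : ℕ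
    p = count (λ y → Z y ∧ adj G y x₀)
    q = count (λ y → Z y ∧ not (adj G y x₀))

    Z⇒¬X : ∀ y → Z y ≡ true → X y ≡ false
    Z⇒¬X y e = not-injective (∧-conicalˡ _ _ e)

    Z⇒ℓ : ∀ y → Z y ≡ true → 𝒞 y ≡ ℓ
    Z⇒ℓ y e = ≡ᵇ-sound (∧-conicalʳ (not (X y)) _ e)

    ¬Z⇒¬ℓ : ∀ y → X y ≡ false → Z y ≡ false → 𝒞 y ≢ ℓ
    ¬Z⇒¬ℓ y Xy Zy same = true≢false (trans (sym (trans (cong (λ b → not b ∧ (𝒞 y ≡ᵇ ℓ)) Xy) (≡ᵇ-true same))) Zy)

    outCost-𝒞 : outCostOn Z 𝒞 ≡ p * (N ∸ a) + q * a
    outCost-𝒞 = outCostOn-uniform Z 𝒞 a Z⇒¬X (λ y Zy → clusterSize-label X 𝒞 y x₀ (Z⇒ℓ y Zy))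

    a≤N : a ≤ N
    a≤N = clusterSize≤count X 𝒞 x₀

    1≤a : 1 ≤ a
    1≤a = clusterSize-pos X 𝒞 x₀ x₀∈u

    module ReattachZ (c : Clustering n) (agree : ∀ z → X z ≡ false → 𝒞 z ≡ c z)
      (same-size : ∀ y → X y ≡ false → Z y ≡ false → clusterSize X 𝒞 y ≡ clusterSize X c y)
      (same-inside : ∀ i j → X i ≡ true → X j ≡ true → (𝒞 i ≡ᵇ 𝒞 j) ≡ (c i ≡ᵇ c j)) where

      cost-difference : cost G 𝒞 + outCostOn Z c ≡ cost G c + outCostOn Z 𝒞
      cost-difference = +-cancelʳ-≡ (costOn G X 𝒞) _ _
        (subst (λ z → cost G 𝒞 + outCostOn Z c + z ≡ cost G c + outCostOn Z 𝒞 + costOn G X 𝒞)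
               (sym (costOn-cong X 𝒞 c same-inside)) (cost-exchange 𝒞 c Z agree same-size))

      outCost-𝒞-minimal : outCostOn Z 𝒞 ≤ outCostOn Z c
      outCost-𝒞-minimal = +-cancelˡ-≤ (cost G c) _ _
        (subst (_≤ cost G c + outCostOn Z c) cost-difference (+-monoˡ-≤ (outCostOn Z c) (optimal c)))

    Moved : Fin n → Bool
    Moved z = X z ∧ (𝒞 z ≡ᵇ ℓ)

    split : Clustering n
    split z = if Moved z then unused else 𝒞 z

    split-moved : ∀ z → Moved z ≡ true → split z ≡ unused
    split-moved z e = cong (λ b → if b then unused else 𝒞 z) e

    split-kept : ∀ z → Moved z ≡ false → split z ≡ 𝒞 z
    split-kept z e = cong (λ b → if b then unused else 𝒞 z) e

    split-outside : ∀ z → X z ≡ false → 𝒞 z ≡ split z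
    split-outside z Xz = sym (split-kept z (false-∧ Xz))

    split-inside : ∀ i j → X i ≡ true → X j ≡ true → (𝒞 i ≡ᵇ 𝒞 j) ≡ (split i ≡ᵇ split j)
    split-inside i j Xi Xj with ≡ᵇ-cases (𝒞 i) ℓ | ≡ᵇ-cases (𝒞 j) ℓ
    ... | inj₁ (i-ℓ , ei) | inj₁ (j-ℓ , ej)
      rewrite split-moved i (true-∧-true Xi ei) | split-moved j (true-∧-true Xj ej) = trans (≡ᵇ-true (trans i-ℓ (sym j-ℓ))) (sym (≡ᵇ-refl unused))
    ... | inj₁ (i-ℓ , ei) | inj₂ (j≢ℓ , ej)
      rewrite split-moved i (true-∧-true Xi ei) | split-kept j (true-∧-false Xj ej) =
        trans (≡ᵇ-false (j≢ℓ ∘ sym ∘ trans (sym i-ℓ))) (sym (≡ᵇ-false (<⇒≢ (label<unused j) ∘ sym)))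
    ... | inj₂ (i≢ℓ , ei) | inj₁ (j-ℓ , ej)
      rewrite split-kept i (true-∧-false Xi ei) | split-moved j (true-∧-true Xj ej) =
        trans (≡ᵇ-false (i≢ℓ ∘ (λ e → trans e j-ℓ))) (sym (≡ᵇ-false (<⇒≢ (label<unused i))))
    ... | inj₂ (_ , ei) | inj₂ (_ , ej)
      rewrite split-kept i (true-∧-false Xi ei) | split-kept j (true-∧-false Xj ej) = refl

    split-size-outside : ∀ y → X y ≡ false → Z y ≡ false → clusterSize X 𝒞 y ≡ clusterSize X split y
    split-size-outside y Xy Zy = count-cong λ w → ∧-cong-true λ Xw → same w Xw
      where
      same : ∀ w → X w ≡ true → (𝒞 w ≡ᵇ 𝒞 y) ≡ (split w ≡ᵇ split y)
      same w Xw with ≡ᵇ-cases (𝒞 w) ℓ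
      ... | inj₁ (w-ℓ , ew) rewrite split-moved w (true-∧-true Xw ew) | sym (split-outside y Xy) =
        trans (≡ᵇ-false (¬Z⇒¬ℓ y Xy Zy ∘ sym ∘ trans (sym w-ℓ))) (sym (≡ᵇ-false (<⇒≢ (label<unused y) ∘ sym)))
      ... | inj₂ (_ , ew) rewrite split-kept w (true-∧-false Xw ew) | sym (split-outside y Xy) = refl

    split-size-Z : ∀ y → Z y ≡ true → clusterSize X split y ≡ 0
    split-size-Z y Zy = count-zero apart
      where
      different : ∀ w → X w ≡ true → (split w ≡ᵇ split y) ≡ false
      different w Xw rewrite sym (split-outside y (Z⇒¬X y Zy)) | Z⇒ℓ y Zy with ≡ᵇ-cases (𝒞 w) ℓ
      ... | inj₁ (_ , ew) rewrite split-moved w (true-∧-true Xw ew) = ≡ᵇ-false (<⇒≢ (label<unused x₀) ∘ sym)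
      ... | inj₂ (_ , ew) rewrite split-kept w (true-∧-false Xw ew) = ew
      apart : ∀ w → X w ∧ (split w ≡ᵇ split y) ≡ false
      apart w with bool-cases (X w)
      ... | inj₁ Xw = true-∧-false Xw (different w Xw)
      ... | inj₂ Xw = false-∧ Xw

    module SplitReattach = ReattachZ split split-outside split-size-outside split-inside

    outCost-split : outCostOn Z split ≡ p * N
    outCost-split = trans (outCostOn-uniform Z split 0 Z⇒¬X split-size-Z) (trans (cong (p * N +_) (*-zeroʳ q)) (+-identityʳ _))

    split-optimal-if : p ≡ q → Optimal G split
    split-optimal-if p≡q c = subst (_≤ cost G c) same-cost (optimal c)
      where
      same-outCost : outCostOn Z 𝒞 ≡ outCostOn Z split
      same-outCost = begin
          outCostOn Z 𝒞                ≡⟨ outCost-𝒞 ⟩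
          p * (N ∸ a) + q * a          ≡⟨ cong (λ z → p * (N ∸ a) + z * a) (sym p≡q) ⟩
          p * (N ∸ a) + p * a          ≡⟨ sym (*-distribˡ-+ p (N ∸ a) a) ⟩
          p * (N ∸ a + a)              ≡⟨ cong (p *_) (m∸n+n≡m a≤N) ⟩
          p * N                        ≡⟨ sym outCost-split ⟩
          outCostOn Z split            ∎
        where open ≡-Reasoning
      same-cost : cost G 𝒞 ≡ cost G split
      same-cost = +-cancelʳ-≡ (outCostOn Z split) _ _
        (trans SplitReattach.cost-difference (cong (cost G split +_) same-outCost))

    split-more-clusters : numClusters 𝒞 < numClusters split
    split-more-clusters = numClusters-split 𝒞 Moved unused ℓ (λ z → <⇒≢ (label<unused z)) (λ z e → ≡ᵇ-sound (∧-conicalʳ (X z) _ e))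
      x₀ y₀ (true-∧-true x₀∈u (≡ᵇ-refl ℓ)) (false-∧ y₀∉u) (sym x₀~y₀)

    split-refines : ∀ i j → split i ≡ split j → 𝒞 i ≡ 𝒞 j × Moved i ≡ Moved j
    split-refines i j e with bool-cases (Moved i) | bool-cases (Moved j)
    ... | inj₁ Mi | inj₁ Mj = trans (≡ᵇ-sound (∧-conicalʳ (X i) _ Mi)) (sym (≡ᵇ-sound (∧-conicalʳ (X j) _ Mj))) , trans Mi (sym Mj)
    ... | inj₁ Mi | inj₂ Mj = ⊥-elim (<⇒≢ (label<unused j) (sym (trans (sym (split-moved i Mi)) (trans e (split-kept j Mj)))))
    ... | inj₂ Mi | inj₁ Mj = ⊥-elim (<⇒≢ (label<unused i) (trans (sym (split-kept i Mi)) (trans e (split-moved j Mj))))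
    ... | inj₂ Mi | inj₂ Mj = trans (sym (split-kept i Mi)) (trans e (split-kept j Mj)) , trans Mi (sym Mj)

    -- a clade V growing in the moved part contains X, so it cannot also contain a kept vertex of ℓ
    clade-straddles-split : ∀ {v} → v ⊑ T → ∀ a₁ b₁ a₂ → inL v a₁ ≡ true → inL v b₁ ≡ false → inL v a₂ ≡ true →
      Moved a₁ ≡ true → Moved b₁ ≡ true → Moved a₂ ≡ false → 𝒞 a₂ ≡ ℓ → ⊥
    clade-straddles-split pv a₁ b₁ a₂ a₁∈v b₁∉v a₂∈v Ma₁ Mb₁ Ma₂ a₂-ℓ
      with clades-laminar pu pv leavesUnique (inList-true⁻ (∧-conicalˡ _ _ Ma₁)) (inList-true⁻ a₁∈v)
    ... | inj₁ X⊆v = true≢false (trans (sym (inList-true (X⊆v (inList-true⁻ (∧-conicalˡ _ _ Mb₁))))) b₁∉v)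
    ... | inj₂ v⊆X = true≢false (trans (sym (true-∧-true (inList-true (v⊆X (inList-true⁻ a₂∈v))) (≡ᵇ-true a₂-ℓ))) Ma₂)

    split-single-growth : AllSingleGrowth T split
    split-single-growth v pv x₁ y₁ x₂ y₂ x₁∈v y₁∉v x₂∈v y₂∉v e₁ e₂
      with split-refines x₁ y₁ e₁ | split-refines x₂ y₂ e₂
    ... | 𝒞₁ , M₁ | 𝒞₂ , M₂ with single-growth v pv x₁ y₁ x₂ y₂ x₁∈v y₁∉v x₂∈v y₂∉v 𝒞₁ 𝒞₂
    ...   | 𝒞x₁≡𝒞x₂ with bool-cases (Moved x₁) | bool-cases (Moved x₂)
    ...     | inj₁ Mx₁ | inj₁ Mx₂ = trans (split-moved x₁ Mx₁) (sym (split-moved x₂ Mx₂))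
    ...     | inj₂ Mx₁ | inj₂ Mx₂ = trans (split-kept x₁ Mx₁) (trans 𝒞x₁≡𝒞x₂ (sym (split-kept x₂ Mx₂)))
    ...     | inj₁ Mx₁ | inj₂ Mx₂ = ⊥-elim (clade-straddles-split pv x₁ y₁ x₂ x₁∈v y₁∉v x₂∈v Mx₁ (trans (sym M₁) Mx₁) Mx₂
                                      (trans (sym 𝒞x₁≡𝒞x₂) (≡ᵇ-sound (∧-conicalʳ (X x₁) _ Mx₁))))
    ...     | inj₂ Mx₁ | inj₁ Mx₂ = ⊥-elim (clade-straddles-split pv x₂ y₂ x₁ x₂∈v y₂∉v x₁∈v Mx₂ (trans (sym M₂) Mx₂) Mx₁
                                      (trans 𝒞x₁≡𝒞x₂ (≡ᵇ-sound (∧-conicalʳ (X x₂) _ Mx₂))))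

    module LargerCluster (v : Fin n) (v∈X : X v ≡ true) (a<b : a < clusterSize X 𝒞 v) where

      b = clusterSize X 𝒞 v
      ℓ′ = 𝒞 v

      ℓ≢ℓ′ : ℓ ≢ ℓ′
      ℓ≢ℓ′ e = <⇒≢ a<b (clusterSize-label X 𝒞 x₀ v e)

      ℓ′-inside : ∀ y → X y ≡ false → 𝒞 y ≢ ℓ′
      ℓ′-inside y Xy e = ℓ≢ℓ′ (sym (single-growth u pu v y x₀ y₀ v∈X Xy x₀∈u y₀∉u (sym e) x₀~y₀))

      swapped : Clustering n
      swapped z = if X z then transpose ℓ ℓ′ (𝒞 z) else 𝒞 z

      swapped-outside : ∀ z → X z ≡ false → 𝒞 z ≡ swapped z
      swapped-outside z Xz = sym (cong (λ b → if b then transpose ℓ ℓ′ (𝒞 z) else 𝒞 z) Xz)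

      swapped-in : ∀ z → X z ≡ true → swapped z ≡ transpose ℓ ℓ′ (𝒞 z)
      swapped-in z Xz = cong (λ b → if b then transpose ℓ ℓ′ (𝒞 z) else 𝒞 z) Xz

      swapped-inside : ∀ i j → X i ≡ true → X j ≡ true → (𝒞 i ≡ᵇ 𝒞 j) ≡ (swapped i ≡ᵇ swapped j)
      swapped-inside i j Xi Xj rewrite swapped-in i Xi | swapped-in j Xj =
        sym (≡ᵇ-preserved (transpose ℓ ℓ′) (transpose-injective ℓ ℓ′ ℓ≢ℓ′) (𝒞 i) (𝒞 j))

      swapped-size-outside : ∀ y → X y ≡ false → Z y ≡ false → clusterSize X 𝒞 y ≡ clusterSize X swapped y
      swapped-size-outside y Xy Zy = count-cong λ w → ∧-cong-true λ Xw → same w Xw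
        where
        same : ∀ w → X w ≡ true → (𝒞 w ≡ᵇ 𝒞 y) ≡ (swapped w ≡ᵇ swapped y)
        same w Xw rewrite swapped-in w Xw | sym (swapped-outside y Xy) =
          sym (transpose-≡ᵇ-other ℓ ℓ′ (𝒞 w) (𝒞 y) (¬Z⇒¬ℓ y Xy Zy) (ℓ′-inside y Xy))

      swapped-size-Z : ∀ y → Z y ≡ true → clusterSize X swapped y ≡ b
      swapped-size-Z y Zy = count-cong λ w → ∧-cong-true λ Xw → same w Xw
        where
        same : ∀ w → X w ≡ true → (swapped w ≡ᵇ swapped y) ≡ (𝒞 w ≡ᵇ 𝒞 v)
        same w Xw rewrite swapped-in w Xw | sym (swapped-outside y (Z⇒¬X y Zy)) | Z⇒ℓ y Zy =
          transpose-≡ᵇ-left ℓ ℓ′ (𝒞 w) ℓ≢ℓ′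

      module SwapReattach = ReattachZ swapped swapped-outside swapped-size-outside swapped-inside

      p≡q : p ≡ q
      p≡q = ≤-antisym p≤q q≤p
        where
        b≤N : b ≤ N
        b≤N = clusterSize≤count X 𝒞 v
        d = b ∸ a
        N∸a≡ : N ∸ a ≡ N ∸ b + d
        N∸a≡ = +-cancelʳ-≡ a _ _ (begin
            N ∸ a + a         ≡⟨ m∸n+n≡m a≤N ⟩
            N                 ≡⟨ sym (m∸n+n≡m b≤N) ⟩
            N ∸ b + b         ≡⟨ cong (N ∸ b +_) (sym (m∸n+n≡m (<⇒≤ a<b))) ⟩
            N ∸ b + (d + a)   ≡⟨ sym (+-assoc (N ∸ b) d a) ⟩
            N ∸ b + d + a     ∎)
          where open ≡-Reasoning
        q≤p : q ≤ p
        q≤p = p*x+q*a≤p*[x+a]⇒q≤p p q (N ∸ a) a 1≤a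
          (subst₂ _≤_ outCost-𝒞 (trans outCost-split (cong (p *_) (sym (m∸n+n≡m a≤N)))) SplitReattach.outCost-𝒞-minimal)
        p≤q : p ≤ q
        p≤q = p*[e+d]+q*a≤p*e+q*[a+d]⇒p≤q p q (N ∸ b) d a (m<n⇒0<n∸m a<b)
          (subst₂ _≤_ (trans outCost-𝒞 (cong (λ z → p * z + q * a) N∸a≡))
                      (trans (outCostOn-uniform Z swapped b Z⇒¬X swapped-size-Z) (cong (λ z → p * (N ∸ b) + q * z) (sym (m+[n∸m]≡n (<⇒≤ a<b)))))
                      SwapReattach.outCost-𝒞-minimal)

    grown-part-largest : clusterSize X 𝒞 x₀ ≡ largestCluster X 𝒞
    grown-part-largest = ≤-antisym (clusterSize≤largest X 𝒞 x₀ x₀∈u) (largest≤ X 𝒞 a bound)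
      where
      bound : ∀ v → X v ≡ true → clusterSize X 𝒞 v ≤ a
      bound v v∈X with ≤-<-connex (clusterSize X 𝒞 v) a
      ... | inj₁ b≤a = b≤a
      ... | inj₂ a<b = ⊥-elim (<⇒≱ split-more-clusters
                         (most-clusters split (split-optimal-if (LargerCluster.p≡q v v∈X a<b)) split-single-growth))

  module OnClade {u : Cotree n} (pu : u ⊑ T) where

    X : Fin n → Bool
    X = inL u

    k* : ℕ
    k* = largestCluster X 𝒞

    fresh : ℕ → ℕ
    fresh m = suc (unused + m)

    fresh-injective : Injective _≡_ _≡_ fresh
    fresh-injective e = +-cancelˡ-≡ unused _ _ (suc-injective e)

    label≢fresh : ∀ z m → 𝒞 z ≢ fresh m
    label≢fresh z m = <⇒≢ (≤-trans (label<unused z) (≤-trans (m≤m+n unused m) (n≤1+n _)))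

    -- qc replaces 𝒞 on X, its largest cluster taking the label L₀ of the cluster in which X grows
    -- (a fresh label if X grows nowhere)
    module Replace (qc : Clustering n) (qc-largest : largestCluster X qc ≡ k*)
      (v₁ : Fin n) (v₁∈X : X v₁ ≡ true) (v₁-largest : clusterSize X qc v₁ ≡ largestCluster X qc)
      (L₀ : ℕ) (fresh≢L₀ : ∀ m → m ≢ qc v₁ → fresh m ≢ L₀)
      (sizes-𝒞 : ∀ y → X y ≡ false → clusterSize X 𝒞 y ≡ (if 𝒞 y ≡ᵇ L₀ then k* else 0)) where

      glue : ℕ → ℕ
      glue = redirect (qc v₁) L₀ fresh

      c′ : Clustering n
      c′ z = if X z then glue (qc z) else 𝒞 z

      c′-outside : ∀ z → X z ≡ false → 𝒞 z ≡ c′ z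
      c′-outside z Xz = sym (cong (λ b → if b then glue (qc z) else 𝒞 z) Xz)

      c′-in : ∀ z → X z ≡ true → c′ z ≡ glue (qc z)
      c′-in z Xz = cong (λ b → if b then glue (qc z) else 𝒞 z) Xz

      c′-inside : ∀ i j → X i ≡ true → X j ≡ true → (c′ i ≡ᵇ c′ j) ≡ (qc i ≡ᵇ qc j)
      c′-inside i j Xi Xj rewrite c′-in i Xi | c′-in j Xj =
        ≡ᵇ-preserved glue (redirect-injective (qc v₁) L₀ fresh fresh-injective fresh≢L₀) (qc i) (qc j)

      sizes-c′ : ∀ y → X y ≡ false → clusterSize X c′ y ≡ (if 𝒞 y ≡ᵇ L₀ then k* else 0)
      sizes-c′ y Xy with ≡ᵇ-cases (𝒞 y) L₀
      ... | inj₁ (y-L₀ , e) rewrite e = trans (count-cong λ w → ∧-cong-true λ Xw → joins w Xw) (trans v₁-largest qc-largest)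
        where
        joins : ∀ w → X w ≡ true → (c′ w ≡ᵇ c′ y) ≡ (qc w ≡ᵇ qc v₁)
        joins w Xw rewrite c′-in w Xw | sym (c′-outside y Xy) | y-L₀ with ≡ᵇ-cases (qc w) (qc v₁)
        ... | inj₁ (_ , e′) rewrite e′ = ≡ᵇ-refl L₀
        ... | inj₂ (w≢v₁ , e′) rewrite e′ = ≡ᵇ-false (fresh≢L₀ (qc w) w≢v₁)
      ... | inj₂ (y≢L₀ , e) rewrite e = count-zero apart
        where
        different : ∀ w → X w ≡ true → (c′ w ≡ᵇ c′ y) ≡ false
        different w Xw rewrite c′-in w Xw | sym (c′-outside y Xy) with ≡ᵇ-cases (qc w) (qc v₁)
        ... | inj₁ (_ , e′) rewrite e′ = ≡ᵇ-false (y≢L₀ ∘ sym)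
        ... | inj₂ (_ , e′) rewrite e′ = ≡ᵇ-false (label≢fresh y (qc w) ∘ sym)
        apart : ∀ w → X w ∧ (c′ w ≡ᵇ c′ y) ≡ false
        apart w with bool-cases (X w)
        ... | inj₁ Xw = true-∧-false Xw (different w Xw)
        ... | inj₂ Xw = false-∧ Xw

      costOn-𝒞≤ : costOn G X 𝒞 ≤ costOn G X qc
      costOn-𝒞≤ = subst (costOn G X 𝒞 ≤_) (costOn-cong X c′ qc c′-inside)
        (+-cancelˡ-≤ (cost G c′) _ _ (subst (_≤ cost G c′ + costOn G X c′) exchanged (+-monoˡ-≤ _ (optimal c′))))
        where
        open InsideModule G X v₁ (adj-uniform pu v₁ v₁∈X)
        exchanged : cost G 𝒞 + costOn G X c′ ≡ cost G c′ + costOn G X 𝒞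
        exchanged = cost-exchange-exact 𝒞 c′ c′-outside (λ y Xy → trans (sizes-𝒞 y Xy) (sym (sizes-c′ y Xy)))

    costOn-clade-minimal : ∀ qc → largestCluster X qc ≡ k* → costOn G X 𝒞 ≤ costOn G X qc
    costOn-clade-minimal qc qc-largest with largest-clade-attained u qc | shared-cluster? X (not ∘ X) 𝒞
    ... | v₁ , v₁∈X , v₁-largest | inj₁ (x₀ , y₀ , x₀∈X , y₀∉X , x₀~y₀) =
      Replace.costOn-𝒞≤ qc qc-largest v₁ v₁∈X v₁-largest (𝒞 x₀) (λ m _ → label≢fresh x₀ m ∘ sym) sizes
      where
      open GrowingClade pu x₀ y₀ x₀∈X (not-injective y₀∉X) x₀~y₀ using (grown-part-largest)
      sizes : ∀ y → X y ≡ false → clusterSize X 𝒞 y ≡ (if 𝒞 y ≡ᵇ 𝒞 x₀ then k* else 0)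
      sizes y Xy with ≡ᵇ-cases (𝒞 y) (𝒞 x₀)
      ... | inj₁ (same , e) rewrite e = trans (clusterSize-label X 𝒞 y x₀ same) grown-part-largest
      ... | inj₂ (y≁x₀ , e) rewrite e = count-zero apart
        where
        apart : ∀ w → X w ∧ (𝒞 w ≡ᵇ 𝒞 y) ≡ false
        apart w with bool-cases (X w)
        ... | inj₂ Xw = false-∧ Xw
        ... | inj₁ Xw = true-∧-false Xw (≡ᵇ-false λ w~y →
                          y≁x₀ (trans (sym w~y) (single-growth u pu w y x₀ y₀ Xw Xy x₀∈X (not-injective y₀∉X) w~y x₀~y₀)))
    ... | v₁ , v₁∈X , v₁-largest | inj₂ no-growth =
      Replace.costOn-𝒞≤ qc qc-largest v₁ v₁∈X v₁-largest (fresh (qc v₁)) (λ m m≢v₁ → m≢v₁ ∘ fresh-injective) sizes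
      where
      sizes : ∀ y → X y ≡ false → clusterSize X 𝒞 y ≡ (if 𝒞 y ≡ᵇ fresh (qc v₁) then k* else 0)
      sizes y Xy rewrite ≡ᵇ-false (label≢fresh y (qc v₁)) = count-zero apart
        where
        apart : ∀ w → X w ∧ (𝒞 w ≡ᵇ 𝒞 y) ≡ false
        apart w with bool-cases (X w)
        ... | inj₂ Xw = false-∧ Xw
        ... | inj₁ Xw = true-∧-false Xw (≡ᵇ-false (no-growth w y Xw (cong not Xy)))

  module _ {ty : NodeType} {l r : Cotree n} (p : node ty l r ⊑ T)
    (exact-l : D l (largestCluster (inL l) 𝒞) ≡ just (costOn G (inL l) 𝒞))
    (exact-r : D r (largestCluster (inL r) 𝒞) ≡ just (costOn G (inL r) 𝒞)) where
    open AtNode p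

    private
      k₁ k₂ c₁ c₂ I : ℕ
      k₁ = largestCluster A 𝒞
      k₂ = largestCluster B 𝒞
      c₁ = costOn G A 𝒞
      c₂ = costOn G B 𝒞
      I = indic ty * size l * size r

      left-option right-option glued-option : ℕ → ℕ∞
      left-option  k = D l k ⊕ minTo k (D r) ⊕ just I
      right-option k = D r k ⊕ minTo k (D l) ⊕ just I
      glued-option k = minTo (k ∸ 1) (λ j → D l j ⊕ D r (k ∸ j) ⊕ just (alpha ty (size l) (size r) k j))

    D-node-apart : (∀ x y → A x ≡ true → B y ≡ true → 𝒞 x ≢ 𝒞 y) → AtMost (D (node ty l r) (largestCluster S 𝒞)) (costOn G S 𝒞)
    D-node-apart apart = by-order (≤-total k₂ k₁)
      where
      glued : GluedAlong A B 𝒞 (λ _ → false) (λ _ → false)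
      glued i j Ai Bj = ≡ᵇ-false (apart i j Ai Bj)
      cost-apart : costOn G S 𝒞 ≡ c₁ + c₂ + I
      cost-apart = trans (costOn-glued 𝒞 _ _ glued) (cong (c₁ + c₂ +_)
        (trans (cong (λ m → crossTerm ty (size l) (size r) (m * count (λ j → B j ∧ false))) (count-zero (λ i → ∧-zeroʳ (A i))))
               (crossTerm-apart ty (size l) (size r))))
      largest-is : ∀ k → k₁ ≡ k ⊎ k₂ ≡ k → k₁ ≤ k → k₂ ≤ k → largestCluster S 𝒞 ≡ k
      largest-is k which k₁≤k k₂≤k = largest-at-node 𝒞 (clusterSize A 𝒞) (clusterSize B 𝒞) k
        (λ v Av → trans (clusterSize-glued-left 𝒞 (λ _ → false) (λ _ → false) glued v Av) (+-identityʳ _))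
        (clusterSize-glued-right 𝒞 (λ _ → false) (λ _ → false) glued)
        (λ v Av → ≤-trans (clusterSize≤largest A 𝒞 v Av) k₁≤k) (λ v Bv → ≤-trans (clusterSize≤largest B 𝒞 v Bv) k₂≤k)
        (attained which)
        where
        attained : k₁ ≡ k ⊎ k₂ ≡ k → (∃ λ v → A v ≡ true × clusterSize A 𝒞 v ≡ k) ⊎ (∃ λ v → B v ≡ true × clusterSize B 𝒞 v ≡ k)
        attained (inj₁ refl) = inj₁ (largest-clade-attained l 𝒞)
        attained (inj₂ refl) = inj₂ (largest-clade-attained r 𝒞)
      by-order : k₂ ≤ k₁ ⊎ k₁ ≤ k₂ → AtMost (D (node ty l r) (largestCluster S 𝒞)) (costOn G S 𝒞)
      by-order (inj₁ k₂≤k₁) = subst (λ k → AtMost (D (node ty l r) k) (costOn G S 𝒞)) (sym (largest-is k₁ (inj₁ refl) ≤-refl k₂≤k₁))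
        (AtMost-weaken (≤-reflexive (sym cost-apart))
          (⊓∞-AtMostˡ (left-option k₁ ⊓∞ right-option k₁) (glued-option k₁) (⊓∞-AtMostˡ (left-option k₁) (right-option k₁)
            (⊕-AtMost (⊕-AtMost (AtMost-just exact-l) (minTo-AtMost k₁ (D r) k₂ (largest-clade-pos r 𝒞) k₂≤k₁ (AtMost-just exact-r)))
                      (AtMost-just refl)))))
      by-order (inj₂ k₁≤k₂) = subst (λ k → AtMost (D (node ty l r) k) (costOn G S 𝒞)) (sym (largest-is k₂ (inj₂ refl) k₁≤k₂ ≤-refl))
        (AtMost-weaken (≤-reflexive (trans (cong (_+ I) (+-comm c₂ c₁)) (sym cost-apart)))
          (⊓∞-AtMostˡ (left-option k₂ ⊓∞ right-option k₂) (glued-option k₂) (⊓∞-AtMostʳ (left-option k₂) (right-option k₂)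
            (⊕-AtMost (⊕-AtMost (AtMost-just exact-r) (minTo-AtMost k₂ (D l) k₁ (largest-clade-pos l 𝒞) k₁≤k₂ (AtMost-just exact-l)))
                      (AtMost-just refl)))))

    D-node-spanned : ∀ x₀ y₀ → A x₀ ≡ true → B y₀ ≡ true → 𝒞 x₀ ≡ 𝒞 y₀ →
      AtMost (D (node ty l r) (largestCluster S 𝒞)) (costOn G S 𝒞)
    D-node-spanned x₀ y₀ Ax₀ By₀ x₀~y₀ =
      subst (λ k → AtMost (D (node ty l r) k) (costOn G S 𝒞)) (sym largest-is-K)
        (AtMost-weaken (≤-reflexive (sym cost-spanned))
          (⊓∞-AtMostʳ (left-option K ⊓∞ right-option K) (glued-option K)
            (minTo-AtMost (K ∸ 1) _ k₁ (largest-clade-pos l 𝒞) k₁≤K∸1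
              (⊕-AtMost (⊕-AtMost (AtMost-just exact-l) (AtMost-just (trans (cong (D r) K∸k₁≡k₂) exact-r))) (AtMost-just refl)))))
      where
      ℓ = 𝒞 x₀
      P : Fin n → Bool
      P i = 𝒞 i ≡ᵇ ℓ
      K = k₁ + k₂
      -- by single growth of the left clade, ℓ is the only cluster meeting both sides
      glued : GluedAlong A B 𝒞 P P
      glued i j Ai Bj with ≡ᵇ-cases (𝒞 i) (𝒞 j)
      ... | inj₁ (i~j , e) rewrite e =
        sym (true-∧-true (≡ᵇ-true i-ℓ) (≡ᵇ-true (trans (sym i~j) i-ℓ)))
        where
        i-ℓ : 𝒞 i ≡ ℓ
        i-ℓ = single-growth l (⊑-trans (left here) p) i j x₀ y₀ Ai (B⇒¬A j Bj) Ax₀ (B⇒¬A y₀ By₀) i~j x₀~y₀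
      ... | inj₂ (i≁j , e) rewrite e with ≡ᵇ-cases (𝒞 i) ℓ
      ...   | inj₁ (i-ℓ , ei) rewrite ei = sym (≡ᵇ-false (i≁j ∘ trans i-ℓ ∘ sym))
      ...   | inj₂ (_ , ei) rewrite ei = refl
      part-l : count (λ i → A i ∧ P i) ≡ k₁
      part-l = GrowingClade.grown-part-largest (⊑-trans (left here) p) x₀ y₀ Ax₀ (B⇒¬A y₀ By₀) x₀~y₀
      part-r : count (λ j → B j ∧ P j) ≡ k₂
      part-r = trans (clusterSize-label B 𝒞 x₀ y₀ x₀~y₀)
                     (GrowingClade.grown-part-largest (⊑-trans (right here) p) y₀ x₀ By₀ (A⇒¬B x₀ Ax₀) (sym x₀~y₀))
      K∸k₁≡k₂ : K ∸ k₁ ≡ k₂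
      K∸k₁≡k₂ = m+n∸m≡n k₁ k₂
      k₁≤K∸1 : k₁ ≤ K ∸ 1
      k₁≤K∸1 = subst (k₁ ≤_) (sym (+-∸-assoc k₁ (largest-clade-pos r 𝒞))) (m≤m+n k₁ (k₂ ∸ 1))
      cost-spanned : costOn G S 𝒞 ≡ c₁ + c₂ + alpha ty (size l) (size r) K k₁
      cost-spanned = trans (costOn-glued 𝒞 P P glued) (cong (c₁ + c₂ +_)
        (trans (cong (crossTerm ty (size l) (size r)) (trans (cong₂ _*_ part-l part-r) (cong (k₁ *_) (sym K∸k₁≡k₂))))
               (crossTerm-glued ty (size l) (size r) K k₁)))
      size-l size-r : Fin n → ℕ
      size-l v = clusterSize A 𝒞 v + (if P v then count (λ j → B j ∧ P j) else 0)
      size-r v = (if P v then count (λ j → A j ∧ P j) else 0) + clusterSize B 𝒞 v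
      bound-l : ∀ v → A v ≡ true → size-l v ≤ K
      bound-l v Av with ≡ᵇ-cases (𝒞 v) ℓ
      ... | inj₁ (v-ℓ , e) rewrite e = ≤-reflexive (cong₂ _+_ (trans (clusterSize-label A 𝒞 v x₀ v-ℓ) part-l) part-r)
      ... | inj₂ (_ , e) rewrite e = ≤-trans (≤-reflexive (+-identityʳ _)) (≤-trans (clusterSize≤largest A 𝒞 v Av) (m≤m+n k₁ k₂))
      bound-r : ∀ v → B v ≡ true → size-r v ≤ K
      bound-r v Bv with ≡ᵇ-cases (𝒞 v) ℓ
      ... | inj₁ (v-ℓ , e) rewrite e = ≤-reflexive (cong₂ _+_ part-l (trans (clusterSize-label B 𝒞 v x₀ v-ℓ) part-r))
      ... | inj₂ (_ , e) rewrite e = ≤-trans (clusterSize≤largest B 𝒞 v Bv) (m≤n+m k₂ k₁)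
      size-x₀ : size-l x₀ ≡ K
      size-x₀ rewrite ≡ᵇ-refl ℓ = cong₂ _+_ part-l part-r
      largest-is-K : largestCluster S 𝒞 ≡ K
      largest-is-K = largest-at-node 𝒞 size-l size-r K (clusterSize-glued-left 𝒞 P P glued) (clusterSize-glued-right 𝒞 P P glued)
                       bound-l bound-r (inj₁ (x₀ , Ax₀ , size-x₀))

    D-node-≤ : AtMost (D (node ty l r) (largestCluster S 𝒞)) (costOn G S 𝒞)
    D-node-≤ with shared-cluster? A B 𝒞
    ... | inj₁ (x₀ , y₀ , Ax₀ , By₀ , x₀~y₀) = D-node-spanned x₀ y₀ Ax₀ By₀ x₀~y₀
    ... | inj₂ apart                         = D-node-apart apart

  cost≤D : ∀ u → u ⊑ T → ∀ d → D u (largestCluster (inL u) 𝒞) ≡ just d → costOn G (inL u) 𝒞 ≤ d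
  cost≤D u pu d e with D-sound u pu _ d e
  ... | qc , cost≤d , qc-largest = ≤-trans (OnClade.costOn-clade-minimal pu qc qc-largest) cost≤d

  D-exact : ∀ u → u ⊑ T → D u (largestCluster (inL u) 𝒞) ≡ just (costOn G (inL u) 𝒞)
  D-exact (leaf x) p rewrite largest-leaf x 𝒞 | costOn-leaf x 𝒞 = refl
  D-exact (node ty l r) p with D-node-≤ p (D-exact l (⊑-trans (left here) p)) (D-exact r (⊑-trans (right here) p))
  ... | d , e , d≤cost = trans e (cong just (≤-antisym d≤cost (cost≤D (node ty l r) p d e)))

lemma5 : ∀ {n} (G : Graph n) (T : Cotree n) →
           TriviallyPerfect G → IsCotreeOf G T → OneNodesNice T →
           (𝒞 : Clustering n) → WellBehaved G T 𝒞 →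
           (u : Cotree n) → u ⊑ T →
           ((k : ℕ) → 1 ≤ k → k ≤ n → (d : ℕ) → D u k ≡ just d →
              ∃ λ (c : Clustering n) →
                costOn G (inL u) c ≤ d × largestCluster (inL u) c ≡ k)
           × D u (largestCluster (inL u) 𝒞) ≡ just (costOn G (inL u) 𝒞)
lemma5 G T _ cot _ 𝒞 wb u pu =
  (λ k _ _ d e → CotreeOf.D-sound G T cot u pu k d e) , WellBehavedClustering.D-exact G T cot 𝒞 wb u pu
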